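{- Let $\theta=\frac12(\sqrt5-1)$ and let $(s_i)_{i\ge0}$ be given by $s_i=\lfloor (i+2)\theta\rfloor-\lfloor (i+1)\theta\rfloor$. Let $n\ge2$ be an integer and put $r=L_{2n}$, $a=F_{2n-1}-1$, $b=L_{2n}-1$. Then $s_{rk+a}=s_{rk+b}$ for all $0\le k\le F_{4n+1}-F_{2n+1}-2$, while for $k=F_{4n+1}-F_{2n+1}-1$ we have $s_{rk+a}=0$ and $s_{rk+b}=1$.
   Context: Fibonacci numbers: $F_0=0$, $F_1=1$, $F_n=F_{n-1}+F_{n-2}$. Lucas numbers: $L_0=2$, $L_1=1$, $L_n=L_{n-1}+L_{n-2}$. -}

module Defs where

open import Data.Nat using (ℕ; zero; suc; _+_; _*_; _∸_; _≤ᵇ_)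
open import Data.Bool using (Bool; if_then_else_)

F : ℕ → ℕ
F 0 = 0
F 1 = 1
F (suc (suc n)) = F (suc n) + F n

L : ℕ → ℕ
L 0 = 2
L 1 = 1
L (suc (suc n)) = L (suc n) + L n

-- θ = (√5 - 1)/2.  For naturals q, m:  q ≤ m θ  ⇔  2q + m ≤ m √5  ⇔  (2q + m)² ≤ 5 m².
leθ : ℕ → ℕ → Bool
leθ q m = (2 * q + m) * (2 * q + m) ≤ᵇ 5 * (m * m)

count : (ℕ → Bool) → ℕ → ℕ
count p zero = 0
count p (suc k) = (if p (suc k) then 1 else 0) + count p k

-- ⌊ m θ ⌋ : since 0 < θ < 1, ⌊ m θ ⌋ = #{ q ∈ {1..m} : q ≤ m θ }
floorθ : ℕ → ℕ
floorθ m = count (λ q → leθ q m) m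

s : ℕ → ℕ
s i = floorθ (i + 2) ∸ floorθ (i + 1)

{-# OPTIONS --safe #-}
module Submission where

-- Since
-- F₂ₙ₊₁ θ = F₂ₙ + θ²ⁿ⁺¹, shifting N by F₂ₙ₊₁ raises ⌊Nθ⌋ by F₂ₙ, or by F₂ₙ + 1
-- exactly when the fractional part of (N + F₂ₙ₊₁)θ lies below θ²ⁿ⁺¹ (a carry).
-- As b - a = F₂ₙ₊₁, the terms s (rk + a) and s (rk + b) agree unless a carry
-- occurs at M = L₂ₙ(k + 1) or M = L₂ₙ(k + 1) + 1.  A carry at M with floor p
-- means Mθ - p = (B - aφ)θ²ⁿ⁺¹ with 0 < B - aφ < 1 and a > 0, that is, a lattice
-- point with M = F₂ₙ a + F₂ₙ₊₁ B; solving this linear equation for M ≡ 0, 1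
-- (mod L₂ₙ) and bounding the solution shows that the first carry is at
-- M = L₂ₙ J + 1 with J = F₄ₙ₊₁ - F₂ₙ₊₁.
--
-- All of this is exact arithmetic in ℤ[φ], with positivity decided through the
-- norm.  With U = F₂ₙ₋₃ and V = F₂ₙ₋₂ every quantity is a polynomial in U and V,
-- and the identities between them hold modulo Cassini's U² + UV - V² = 1.

open import Defs
open import Data.Nat as ℕ using (ℕ; suc)
open import Data.Integer using (ℤ; +_)
open import Relation.Binary.PropositionalEquality using (_≡_)

module GoldenIntegers where

  open import Data.Nat as ℕ using (ℕ; zero; suc; z≤n; s≤s)
  import Data.Nat.Properties as ℕ
  open import Data.Nat.Induction using (<-wellFounded)
  open import Data.Integer using (ℤ; +_; -[1+_]; _+_; _*_; -_; _-_; _≤_; _<_; +≤+; +<+)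
  import Data.Integer.Properties as ℤ
  open import Data.Integer.Tactic.RingSolver using (solve-∀)
  open import Data.Product using (_×_; _,_; proj₁; proj₂; ∃-syntax)
  open import Data.Sum using (_⊎_; inj₁; inj₂)
  open import Data.Empty using (⊥; ⊥-elim)
  open import Induction.WellFounded using (Acc; acc)
  open import Relation.Binary.Definitions using (tri<; tri≈; tri>)
  open import Relation.Binary.PropositionalEquality
  open import Relation.Nullary using (¬_; yes; no)
  open import Function using (_∘_)

  infixl 6 _⊕_ _⊖_
  infixl 7 _⊗_
  infixr 8 ⊝_ θ·_ φ·_ φ^_·_

  -- (a , b) stands for a + bφ, where φ² = φ + 1, and θ = φ - 1 = 1/φ.
  ℤφ : Set
  ℤφ = ℤ × ℤ

  0φ 1φ : ℤφ
  0φ = + 0 , + 0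
  1φ = + 1 , + 0

  _⊕_ : ℤφ → ℤφ → ℤφ
  (a , b) ⊕ (c , d) = a + c , b + d

  ⊝_ : ℤφ → ℤφ
  ⊝ (a , b) = - a , - b

  _⊖_ : ℤφ → ℤφ → ℤφ
  x ⊖ y = x ⊕ ⊝ y

  _⊗_ : ℤφ → ℤφ → ℤφ
  (a , b) ⊗ (c , d) = a * c + b * d , a * d + b * c + b * d

  ι : ℤ → ℤφ
  ι a = a , + 0

  θ·_ : ℤ → ℤφ
  θ· m = - m , m

  φ·_ : ℤφ → ℤφ
  φ· (a , b) = b , a + b

  φ^_·_ : ℕ → ℤφ → ℤφ
  φ^ zero · x = x
  φ^ suc k · x = φ· (φ^ k · x)

  conj : ℤφ → ℤφ
  conj (a , b) = a + b , - b

  norm : ℤφ → ℤ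
  norm (a , b) = a * a + a * b - b * b

  ≡-by-coords : ∀ {x y : ℤφ} → proj₁ x ≡ proj₁ y → proj₂ x ≡ proj₂ y → x ≡ y
  ≡-by-coords {_ , _} {_ , _} = cong₂ _,_

  φ·-⊕ : ∀ x y → φ· (x ⊕ y) ≡ φ· x ⊕ φ· y
  φ·-⊕ (a , b) (c , d) = ≡-by-coords refl (im a b c d)
    where
    im : ∀ a b c d → a + c + (b + d) ≡ a + b + (c + d)
    im = solve-∀

  φ·-⊗ : ∀ x y → φ· (x ⊗ y) ≡ φ· x ⊗ y
  φ·-⊗ (a , b) (c , d) = ≡-by-coords (re a b c d) (im a b c d)
    where
    re : ∀ a b c d → a * d + b * c + b * d ≡ b * c + (a + b) * d
    re = solve-∀
    im : ∀ a b c d → a * c + b * d + (a * d + b * c + b * d) ≡ b * d + (a + b) * c + (a + b) * d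
    im = solve-∀

  ⊗-comm : ∀ x y → x ⊗ y ≡ y ⊗ x
  ⊗-comm (a , b) (c , d) = ≡-by-coords (re a b c d) (im a b c d)
    where
    re : ∀ a b c d → a * c + b * d ≡ c * a + d * b
    re = solve-∀
    im : ∀ a b c d → a * d + b * c + b * d ≡ c * b + d * a + d * b
    im = solve-∀

  ⊝-⊗ : ∀ x y → ⊝ x ⊗ y ≡ ⊝ (x ⊗ y)
  ⊝-⊗ (a , b) (c , d) = ≡-by-coords (re a b c d) (im a b c d)
    where
    re : ∀ a b c d → - a * c + - b * d ≡ - (a * c + b * d)
    re = solve-∀
    im : ∀ a b c d → - a * d + - b * c + - b * d ≡ - (a * d + b * c + b * d)
    im = solve-∀

  ⊖-self : ∀ x → x ⊖ x ≡ 0φ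
  ⊖-self (a , b) = ≡-by-coords (ℤ.+-inverseʳ a) (ℤ.+-inverseʳ b)

  ⊝-⊖ : ∀ x y → ⊝ (x ⊖ y) ≡ y ⊖ x
  ⊝-⊖ (a , b) (c , d) = ≡-by-coords (re a b c d) (im a b c d)
    where
    re : ∀ a b c d → - (a + - c) ≡ c + - a
    re = solve-∀
    im : ∀ a b c d → - (b + - d) ≡ d + - b
    im = solve-∀

  ⊗-conj : ∀ x → x ⊗ conj x ≡ ι (norm x)
  ⊗-conj (a , b) = ≡-by-coords (re a b) (im a b)
    where
    re : ∀ a b → a * (a + b) + b * - b ≡ a * a + a * b - b * b
    re = solve-∀
    im : ∀ a b → a * - b + b * (a + b) + b * - b ≡ + 0
    im = solve-∀

  φ^-⊕ : ∀ k x y → φ^ k · (x ⊕ y) ≡ φ^ k · x ⊕ φ^ k · y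
  φ^-⊕ zero x y = refl
  φ^-⊕ (suc k) x y = trans (cong φ·_ (φ^-⊕ k x y)) (φ·-⊕ (φ^ k · x) (φ^ k · y))

  φ^-⊗ : ∀ k x y → φ^ k · (x ⊗ y) ≡ φ^ k · x ⊗ y
  φ^-⊗ zero x y = refl
  φ^-⊗ (suc k) x y = trans (cong φ·_ (φ^-⊗ k x y)) (φ·-⊗ (φ^ k · x) y)

  φ^-+ : ∀ k l x → φ^ (k ℕ.+ l) · x ≡ φ^ k · φ^ l · x
  φ^-+ zero l x = refl
  φ^-+ (suc k) l x = cong φ·_ (φ^-+ k l x)

  φ^-φ· : ∀ k x → φ^ k · φ· x ≡ φ· (φ^ k · x)
  φ^-φ· zero x = refl
  φ^-φ· (suc k) x = cong φ·_ (φ^-φ· k x)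

  φ^-0φ : ∀ k → φ^ k · 0φ ≡ 0φ
  φ^-0φ zero = refl
  φ^-0φ (suc k) rewrite φ^-0φ k = refl

  PositiveCoords NonNegCoords : ℤφ → Set
  PositiveCoords (a , b) = + 0 ≤ a × + 0 < b
  NonNegCoords (a , b) = + 0 ≤ a × + 0 ≤ b

  -- x > 0 as a real number iff some φᵏ x has coordinates a ≥ 0 and b > 0; in this
  -- form closure under sums and products is immediate.
  Positive : ℤφ → Set
  Positive x = ∃[ k ] PositiveCoords (φ^ k · x)

  0≤+ : ∀ {a b} → + 0 ≤ a → + 0 ≤ b → + 0 ≤ a + b
  0≤+ = ℤ.+-mono-≤

  0≤* : ∀ {a b} → + 0 ≤ a → + 0 ≤ b → + 0 ≤ a * b
  0≤* {+ a} {+ b} _ _ = subst (+ 0 ≤_) (ℤ.pos-* a b) (+≤+ z≤n)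

  0<* : ∀ {a b} → + 0 < a → + 0 < b → + 0 < a * b
  0<* {+ suc a} {+ suc b} (+<+ _) (+<+ _) = +<+ (s≤s z≤n)

  positiveCoords-⊕ : ∀ x y → PositiveCoords x → NonNegCoords y → PositiveCoords (x ⊕ y)
  positiveCoords-⊕ (a , b) (c , d) (a≥0 , b>0) (c≥0 , d≥0) = 0≤+ a≥0 c≥0 , ℤ.+-mono-<-≤ b>0 d≥0

  positiveCoords-⊗ : ∀ x y → PositiveCoords x → PositiveCoords y → PositiveCoords (x ⊗ y)
  positiveCoords-⊗ (a , b) (c , d) (a≥0 , b>0) (c≥0 , d>0) =
    0≤+ (0≤* a≥0 c≥0) (ℤ.<⇒≤ (0<* b>0 d>0)) ,
    ℤ.+-mono-≤-< (0≤+ (0≤* a≥0 (ℤ.<⇒≤ d>0)) (0≤* (ℤ.<⇒≤ b>0) c≥0)) (0<* b>0 d>0)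

  positiveCoords⇒nonNegCoords : ∀ x → PositiveCoords x → NonNegCoords x
  positiveCoords⇒nonNegCoords (a , b) (a≥0 , b>0) = a≥0 , ℤ.<⇒≤ b>0

  positiveCoords-φ· : ∀ x → PositiveCoords x → PositiveCoords (φ· x)
  positiveCoords-φ· (a , b) (a≥0 , b>0) = ℤ.<⇒≤ b>0 , ℤ.+-mono-≤-< a≥0 b>0

  nonNegCoords-φ^ : ∀ k x → NonNegCoords x → NonNegCoords (φ^ k · x)
  nonNegCoords-φ^ zero x h = h
  nonNegCoords-φ^ (suc k) x h with φ^ k · x | nonNegCoords-φ^ k x h
  ... | a , b | a≥0 , b≥0 = b≥0 , 0≤+ a≥0 b≥0

  positiveCoords-φ^ : ∀ d k x → PositiveCoords (φ^ k · x) → PositiveCoords (φ^ (d ℕ.+ k) · x)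
  positiveCoords-φ^ zero k x h = h
  positiveCoords-φ^ (suc d) k x h = positiveCoords-φ· (φ^ (d ℕ.+ k) · x) (positiveCoords-φ^ d k x h)

  positive-⊕ : ∀ {x y} → Positive x → Positive y → Positive (x ⊕ y)
  positive-⊕ {x} {y} (k , hx) (l , hy) = l ℕ.+ k ,
    subst PositiveCoords (sym (φ^-⊕ (l ℕ.+ k) x y))
      (positiveCoords-⊕ _ _ (positiveCoords-φ^ l k x hx)
        (positiveCoords⇒nonNegCoords _ (subst (λ i → PositiveCoords (φ^ i · y)) (ℕ.+-comm k l) (positiveCoords-φ^ k l y hy))))

  positive-⊕-nonNeg : ∀ {x y} → Positive x → NonNegCoords y → Positive (x ⊕ y)
  positive-⊕-nonNeg {x} {y} (k , hx) hy = k ,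
    subst PositiveCoords (sym (φ^-⊕ k x y)) (positiveCoords-⊕ _ _ hx (nonNegCoords-φ^ k y hy))

  positive-⊗ : ∀ {x y} → Positive x → Positive y → Positive (x ⊗ y)
  positive-⊗ {x} {y} (k , hx) (l , hy) = k ℕ.+ l , subst PositiveCoords (sym φ^ᵏ⁺ˡ[xy]) (positiveCoords-⊗ _ _ hx hy)
    where
    φ^ˡ[xy] : φ^ l · (x ⊗ y) ≡ x ⊗ φ^ l · y
    φ^ˡ[xy] = trans (cong (φ^ l ·_) (⊗-comm x y)) (trans (φ^-⊗ l y x) (⊗-comm (φ^ l · y) x))
    φ^ᵏ⁺ˡ[xy] : φ^ (k ℕ.+ l) · (x ⊗ y) ≡ φ^ k · x ⊗ φ^ l · y
    φ^ᵏ⁺ˡ[xy] = trans (φ^-+ k l (x ⊗ y)) (trans (cong (φ^ k ·_) φ^ˡ[xy]) (φ^-⊗ k x (φ^ l · y)))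

  positive-φ·⁻¹ : ∀ {x} → Positive (φ· x) → Positive x
  positive-φ·⁻¹ {x} (k , h) = suc k , subst PositiveCoords (φ^-φ· k x) h

  positive-φ²⁻¹ : ∀ {x} → Positive (φ· φ· x) → Positive x
  positive-φ²⁻¹ = positive-φ·⁻¹ ∘ positive-φ·⁻¹

  positive-coords : ∀ {a b} → + 0 ≤ a → + 0 ≤ b → + 0 < a + b → Positive (a , b)
  positive-coords a≥0 b≥0 a+b>0 = 1 , b≥0 , a+b>0

  ¬positive-0φ : ¬ Positive 0φ
  ¬positive-0φ (k , h) with subst PositiveCoords (φ^-0φ k) h
  ... | _ , +<+ ()

  positive-asym : ∀ {x} → Positive x → Positive (⊝ x) → ⊥
  positive-asym {x} h h' = ¬positive-0φ (subst Positive (⊖-self x) (positive-⊕ h h'))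

  positive-⊖-nonNeg : ∀ {x} → Positive x → NonNegCoords (⊝ x) → ⊥
  positive-⊖-nonNeg {x} h n = ¬positive-0φ (subst Positive (⊖-self x) (positive-⊕-nonNeg h n))

  Sign : ℤφ → Set
  Sign x = Positive x ⊎ x ≡ 0φ ⊎ Positive (⊝ x)

  φ·[-a+bφ] : ∀ a d b → a ℕ.+ d ≡ suc b → φ· (- + a , + suc b) ≡ (+ suc b , + d)
  φ·[-a+bφ] a d b a+d≡1+b rewrite sym a+d≡1+b = cong (+ (a ℕ.+ d) ,_) (lemma (+ a) (+ d))
    where
    lemma : ∀ A D → - A + (A + D) ≡ D
    lemma = solve-∀

  φ²·[a-bφ]₁ : ∀ a b o e → suc (suc b) ℕ.+ o ≡ a → suc b ℕ.+ e ≡ suc o → φ· φ· (+ a , - + suc b) ≡ (+ suc o , + e)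
  φ²·[a-bφ]₁ a b o e refl refl = cong₂ _,_ (lemma₁ (+ b) (+ e)) (lemma₂ (+ b) (+ e))
    where
    lemma₁ : ∀ b e → + 1 + (+ 1 + (b + (b + e))) + - (+ 1 + b) ≡ + 1 + (b + e)
    lemma₁ = solve-∀
    lemma₂ : ∀ b e → - (+ 1 + b) + (+ 1 + (+ 1 + (b + (b + e))) + - (+ 1 + b)) ≡ e
    lemma₂ = solve-∀

  φ²·[a-bφ]₂ : ∀ a b o e → suc (suc b) ℕ.+ o ≡ a → suc (suc o) ℕ.+ e ≡ suc b → φ· φ· (+ a , - + suc b) ≡ (+ suc o , - + suc e)
  φ²·[a-bφ]₂ a b o e refl refl = cong₂ _,_ (lemma₁ (+ o) (+ e)) (lemma₂ (+ o) (+ e))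
    where
    lemma₁ : ∀ o e → + 1 + (+ 1 + (+ 1 + (o + e) + o)) + - (+ 1 + (+ 1 + (o + e))) ≡ + 1 + o
    lemma₁ = solve-∀
    lemma₂ : ∀ o e → - (+ 1 + (+ 1 + (o + e))) + (+ 1 + (+ 1 + (+ 1 + (o + e) + o)) + - (+ 1 + (+ 1 + (o + e)))) ≡ - (+ 1 + e)
    lemma₂ = solve-∀

  φ²·-⊝ : ∀ x → φ· φ· ⊝ x ≡ ⊝ φ· φ· x
  φ²·-⊝ (a , b) = ≡-by-coords (re a b) (im a b)
    where
    re : ∀ a b → - a + - b ≡ - (a + b)
    re = solve-∀
    im : ∀ a b → - b + (- a + - b) ≡ - (b + (a + b))
    im = solve-∀

  -- Descent: for b < a < 2b, (a - bφ)φ² = (a - b) - (2b - a)φ has a smaller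
  -- first coordinate and the same sign.
  sign-a-bφ : ∀ a b → Acc ℕ._<_ a → Sign (+ a , - + b)
  sign-a-bφ zero zero _ = inj₂ (inj₁ refl)
  sign-a-bφ (suc a) zero _ = inj₁ (positive-coords (+≤+ z≤n) (+≤+ z≤n) (+<+ (s≤s z≤n)))
  sign-a-bφ a (suc b) (acc rec) with a ℕ.≤? suc b
  ... | yes a≤1+b = let d , a+d≡1+b = ℕ.m≤n⇒∃[o]m+o≡n a≤1+b in
    inj₂ (inj₂ (positive-φ·⁻¹ (subst Positive (sym (φ·[-a+bφ] a d b a+d≡1+b))
      (positive-coords (+≤+ z≤n) (+≤+ z≤n) (+<+ (s≤s z≤n))))))
  ... | no a≰1+b with ℕ.m≤n⇒∃[o]m+o≡n (ℕ.≰⇒> a≰1+b)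
  ...   | o , 2+b+o≡a with suc b ℕ.≤? suc o
  ...     | yes 1+b≤1+o = let e , 1+b+e≡1+o = ℕ.m≤n⇒∃[o]m+o≡n 1+b≤1+o in
    inj₁ (positive-φ²⁻¹ (subst Positive (sym (φ²·[a-bφ]₁ a b o e 2+b+o≡a 1+b+e≡1+o))
      (positive-coords (+≤+ z≤n) (+≤+ z≤n) (+<+ (s≤s z≤n)))))
  ...     | no 1+b≰1+o with ℕ.m≤n⇒∃[o]m+o≡n (ℕ.≰⇒> 1+b≰1+o)
  ...       | e , 2+o+e≡1+b with sign-a-bφ (suc o) (suc e) (rec (1+o<a a b o 2+b+o≡a))
    where
    1+o<a : ∀ a b o → suc (suc b) ℕ.+ o ≡ a → suc o ℕ.< a
    1+o<a a b o refl = s≤s (s≤s (ℕ.m≤n+m o b))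
  ... | inj₁ pos = inj₁ (positive-φ²⁻¹ (subst Positive (sym (φ²·[a-bφ]₂ a b o e 2+b+o≡a 2+o+e≡1+b)) pos))
  ... | inj₂ (inj₁ ())
  ... | inj₂ (inj₂ neg) = inj₂ (inj₂ (positive-φ²⁻¹
    (subst Positive (trans (cong ⊝_ (sym (φ²·[a-bφ]₂ a b o e 2+b+o≡a 2+o+e≡1+b))) (sym (φ²·-⊝ (+ a , - + suc b)))) neg)))

  trichotomy : ∀ x → Sign x
  trichotomy (+ zero , + zero) = inj₂ (inj₁ refl)
  trichotomy (+ zero , + suc b) = inj₁ (positive-coords (+≤+ z≤n) (+≤+ z≤n) (+<+ (s≤s z≤n)))
  trichotomy (+ suc a , + b) = inj₁ (positive-coords (+≤+ z≤n) (+≤+ z≤n) (+<+ (s≤s z≤n)))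
  trichotomy (+ a , -[1+ b ]) = sign-a-bφ a (suc b) (<-wellFounded a)
  trichotomy (-[1+ a ] , + zero) = inj₂ (inj₂ (positive-coords (+≤+ z≤n) (+≤+ z≤n) (+<+ (s≤s z≤n))))
  trichotomy (-[1+ a ] , + suc b) with sign-a-bφ (suc a) (suc b) (<-wellFounded (suc a))
  ... | inj₁ neg = inj₂ (inj₂ neg)
  ... | inj₂ (inj₁ ())
  ... | inj₂ (inj₂ pos) = inj₁ pos
  trichotomy (-[1+ a ] , -[1+ b ]) = inj₂ (inj₂ (positive-coords (+≤+ z≤n) (+≤+ z≤n) (+<+ (s≤s z≤n))))

  positive-cancelʳ : ∀ {x y} → Positive (x ⊗ y) → Positive y → Positive x
  positive-cancelʳ {x} {y} xy>0 y>0 with trichotomy x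
  ... | inj₁ x>0 = x>0
  ... | inj₂ (inj₁ refl) = ⊥-elim (¬positive-0φ xy>0)
  ... | inj₂ (inj₂ -x>0) = ⊥-elim (positive-asym xy>0 (subst Positive (⊝-⊗ x y) (positive-⊗ -x>0 y>0)))

  ¬positive-⊝⇒positive : ∀ {x} → x ≢ 0φ → ¬ Positive (⊝ x) → Positive x
  ¬positive-⊝⇒positive {x} x≢0 -x≯0 with trichotomy x
  ... | inj₁ x>0 = x>0
  ... | inj₂ (inj₁ x≡0) = ⊥-elim (x≢0 x≡0)
  ... | inj₂ (inj₂ -x>0) = ⊥-elim (-x≯0 -x>0)

  positive-ι⇒0< : ∀ {a} → Positive (ι a) → + 0 < a
  positive-ι⇒0< {a} h with ℤ.<-cmp (+ 0) a
  ... | tri< 0<a _ _ = 0<a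
  ... | tri≈ _ refl _ = ⊥-elim (¬positive-0φ h)
  ... | tri> _ _ a<0 = ⊥-elim (positive-⊖-nonNeg h (ℤ.<⇒≤ (ℤ.neg-mono-< a<0) , +≤+ z≤n))

  0<⇒positive-ι : ∀ {a} → + 0 < a → Positive (ι a)
  0<⇒positive-ι 0<a = positive-coords (ℤ.<⇒≤ 0<a) (+≤+ z≤n) (ℤ.+-mono-<-≤ 0<a (+≤+ z≤n))

  positive⇒0<norm : ∀ {x} → Positive x → Positive (conj x) → + 0 < norm x
  positive⇒0<norm {x} x>0 x̄>0 = positive-ι⇒0< (subst Positive (⊗-conj x) (positive-⊗ x>0 x̄>0))

  0<norm⇒positive : ∀ {x} → + 0 < norm x → Positive (conj x) → Positive x
  0<norm⇒positive {x} 0<N x̄>0 with trichotomy x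
  ... | inj₁ x>0 = x>0
  ... | inj₂ (inj₁ refl) = ⊥-elim (ℤ.<-irrefl refl 0<N)
  ... | inj₂ (inj₂ -x>0) = ⊥-elim (positive-asym (0<⇒positive-ι 0<N)
    (subst Positive (trans (⊝-⊗ x (conj x)) (cong ⊝_ (⊗-conj x))) (positive-⊗ -x>0 x̄>0)))

  θ : ℤφ
  θ = θ· + 1

  positive-θ : Positive θ
  positive-θ = positive-φ·⁻¹ (positive-coords (+≤+ z≤n) (+≤+ z≤n) (+<+ (s≤s z≤n)))

  positive-θ² : Positive (θ ⊗ θ)
  positive-θ² = positive-φ·⁻¹ positive-θ

  0<⇒0≤pred : ∀ {a} → + 0 < a → + 0 ≤ a - + 1
  0<⇒0≤pred {+ suc n} (+<+ _) = +≤+ z≤n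

  positive-ι⇒≤ : ∀ {a b} → Positive (ι (+ 1 + a - b)) → b ≤ a
  positive-ι⇒≤ {a} {b} h = ℤ.0≤i-j⇒j≤i (subst (+ 0 ≤_) (lemma a b) (0<⇒0≤pred (positive-ι⇒0< h)))
    where
    lemma : ∀ a b → + 1 + a - b - + 1 ≡ a - b
    lemma = solve-∀

  positiveCoords⇒positive : ∀ {x} → PositiveCoords x → Positive x
  positiveCoords⇒positive h = 0 , h

  positive-1φ : Positive 1φ
  positive-1φ = positive-coords (+≤+ z≤n) (+≤+ z≤n) (+<+ (s≤s z≤n))

  positive-by-product : ∀ {x y z} → x ⊗ y ≡ z → Positive z → Positive y → Positive x
  positive-by-product xy≡z z>0 y>0 = positive-cancelʳ (subst Positive (sym xy≡z) z>0) y>0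

  -- If a > 0 then (1 - x) + conj x + 2aθ = 1 - a would be positive; if a = 0 then x
  -- would be an integer strictly between 0 and 1.
  fraction-with-positive-conj⇒a<0 : ∀ {b a} → Positive (b , a) → Positive (+ 1 - b , - a) → Positive (conj (b , a)) → a < + 0
  fraction-with-positive-conj⇒a<0 {b} {a} x>0 1-x>0 x̄>0 with ℤ.<-cmp a (+ 0)
  ... | tri< a<0 _ _ = a<0
  ... | tri≈ _ refl _ = ⊥-elim (ℤ.<⇒≱ (positive-ι⇒0< x>0) (positive-ι⇒≤ {+ 0} 1-x>0))
  ... | tri> _ _ 0<a = ⊥-elim (ℤ.<⇒≱ 0<a (positive-ι⇒≤ {+ 0}
    (subst Positive (sum b a) (positive-⊕ (positive-⊕ 1-x>0 x̄>0) (positive-⊗ (0<⇒positive-ι (ℤ.+-mono-< 0<a 0<a)) positive-θ)))))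
    where
    sum : ∀ b a → (+ 1 - b , - a) ⊕ conj (b , a) ⊕ ι (a + a) ⊗ θ ≡ ι (+ 1 + + 0 - a)
    sum b a = ≡-by-coords (re b a) (im b a)
      where
      re : ∀ b a → + 1 - b + (b + a) + ((a + a) * - (+ 1) + + 0 * + 1) ≡ + 1 + + 0 - a
      re = solve-∀
      im : ∀ b a → - a + - a + ((a + a) * + 1 + + 0 * - (+ 1) + + 0 * + 1) ≡ + 0
      im = solve-∀

  positive-⊕-scaled : ∀ {x k y} → Positive x → + 0 ≤ k → Positive y → Positive (x ⊕ ι k ⊗ y)
  positive-⊕-scaled {x} {+ zero} {y₁ , y₂} x>0 _ _ = subst Positive (x≡x⊕0y x y₁ y₂) x>0
    where
    x≡x⊕0y : ∀ x y₁ y₂ → x ≡ x ⊕ ι (+ 0) ⊗ (y₁ , y₂)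
    x≡x⊕0y (x₁ , x₂) y₁ y₂ = ≡-by-coords (re x₁ x₂ y₁ y₂) (im x₁ x₂ y₁ y₂)
      where
      re : ∀ x₁ x₂ y₁ y₂ → x₁ ≡ x₁ + (+ 0 * y₁ + + 0 * y₂)
      re = solve-∀
      im : ∀ x₁ x₂ y₁ y₂ → x₂ ≡ x₂ + (+ 0 * y₂ + + 0 * y₁ + + 0 * y₂)
      im = solve-∀
  positive-⊕-scaled {k = + suc n} x>0 _ y>0 = positive-⊕ x>0 (positive-⊗ (0<⇒positive-ι {+ suc n} (+<+ (s≤s z≤n))) y>0)

  ≤0⊎0< : ∀ x → x ≤ + 0 ⊎ + 0 < x
  ≤0⊎0< x with + 0 ℤ.<? x
  ... | yes 0<x = inj₂ 0<x
  ... | no 0≮x = inj₁ (ℤ.≮⇒≥ 0≮x)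

  nonNeg-[2+φ] : ∀ {x} → + 0 ≤ x → NonNegCoords (x * + 2 , x)
  nonNeg-[2+φ] 0≤x = 0≤* 0≤x (+≤+ z≤n) , 0≤x

  y+[x-y]≡x : ∀ x y → y + (x - y) ≡ x
  y+[x-y]≡x = solve-∀

  0<x-y⇒y<x : ∀ {x y} → + 0 < x - y → y < x
  0<x-y⇒y<x {x} {y} 0<x-y = subst₂ _<_ (ℤ.+-identityʳ y) (y+[x-y]≡x x y) (ℤ.+-monoʳ-< y 0<x-y)

module Floorθ where

  open import Data.Nat as ℕ using (ℕ; zero; suc; z≤n; s≤s; _≤ᵇ_)
  import Data.Nat.Properties as ℕ
  open import Data.Nat.Tactic.RingSolver renaming (solve-∀ to solveℕ)
  open import Data.Integer using (ℤ; +_; _+_; _*_; -_; _-_; _≤_; _<_; +≤+; +<+)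
  import Data.Integer.Properties as ℤ
  open import Data.Integer.Tactic.RingSolver using (solve-∀)
  open import Data.Bool using (true; false; T)
  open import Data.Unit using (tt)
  open import Data.Product using (_×_; _,_; proj₁; proj₂)
  open import Data.Sum using (_⊎_; inj₁; inj₂)
  open import Data.Empty using (⊥-elim)
  open import Relation.Binary.PropositionalEquality
  open import Relation.Nullary using (¬_; yes; no)
  open import Function using (_∘_)
  open GoldenIntegers

  count≤ : ∀ p k → count p k ℕ.≤ k
  count≤ p zero = z≤n
  count≤ p (suc k) with p (suc k)
  ... | true = s≤s (count≤ p k)
  ... | false = ℕ.m≤n⇒m≤1+n (count≤ p k)

  count-downClosed : ∀ p → p 0 ≡ true → (∀ {a b} → a ℕ.≤ b → p b ≡ true → p a ≡ true) → ∀ k →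
    p (count p k) ≡ true × (count p k ≡ k ⊎ p (suc (count p k)) ≡ false)
  count-downClosed p p0 down zero = p0 , inj₁ refl
  count-downClosed p p0 down (suc k) with p (suc k) in pk | count-downClosed p p0 down k
  ... | true | pc , inj₁ c≡k = subst (λ q → p q ≡ true) (cong suc (sym c≡k)) pk , inj₁ (cong suc c≡k)
  ... | true | pc , inj₂ pc+1 with () ← trans (sym pc+1) (down (s≤s (count≤ p k)) pk)
  ... | false | pc , inj₁ c≡k = pc , inj₂ (trans (cong (λ q → p (suc q)) c≡k) pk)
  ... | false | pc , inj₂ pc+1 = pc , inj₂ pc+1

  [2q+M]²≡ : ∀ q M → (2 ℕ.* q ℕ.+ M) ℕ.* (2 ℕ.* q ℕ.+ M) ≡ 4 ℕ.* (q ℕ.* q ℕ.+ q ℕ.* M) ℕ.+ M ℕ.* M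
  [2q+M]²≡ = solveℕ

  5M²≡ : ∀ M → 5 ℕ.* (M ℕ.* M) ≡ 4 ℕ.* (M ℕ.* M) ℕ.+ M ℕ.* M
  5M²≡ = solveℕ

  leθ⇒ : ∀ q M → leθ q M ≡ true → q ℕ.* q ℕ.+ q ℕ.* M ℕ.≤ M ℕ.* M
  leθ⇒ q M h = ℕ.*-cancelˡ-≤ 4 (ℕ.+-cancelʳ-≤ (M ℕ.* M) _ _
    (subst₂ ℕ._≤_ ([2q+M]²≡ q M) (5M²≡ M) (ℕ.≤ᵇ⇒≤ _ _ (subst T (sym h) tt))))

  ¬leθ⇒ : ∀ q M → leθ q M ≡ false → M ℕ.* M ℕ.< q ℕ.* q ℕ.+ q ℕ.* M
  ¬leθ⇒ q M h = ℕ.≰⇒> λ le → subst T h (ℕ.≤⇒≤ᵇ (subst₂ ℕ._≤_ (sym ([2q+M]²≡ q M)) (sym (5M²≡ M))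
    (ℕ.+-monoˡ-≤ (M ℕ.* M) (ℕ.*-monoʳ-≤ 4 le))))

  ⇒leθ : ∀ q M → q ℕ.* q ℕ.+ q ℕ.* M ℕ.≤ M ℕ.* M → leθ q M ≡ true
  ⇒leθ q M le with leθ q M in h
  ... | true = refl
  ... | false = ⊥-elim (ℕ.<⇒≱ (¬leθ⇒ q M h) le)

  leθ-0 : ∀ M → leθ 0 M ≡ true
  leθ-0 M = ⇒leθ 0 M z≤n

  leθ-downClosed : ∀ M {a b} → a ℕ.≤ b → leθ b M ≡ true → leθ a M ≡ true
  leθ-downClosed M {a} {b} a≤b h = ⇒leθ a M (ℕ.≤-trans (ℕ.+-mono-≤ (ℕ.*-mono-≤ a≤b a≤b) (ℕ.*-monoˡ-≤ M a≤b)) (leθ⇒ b M h))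

  leθ-self : ∀ M → 0 ℕ.< M → leθ M M ≡ false
  leθ-self M 0<M with leθ M M in h
  ... | false = refl
  ... | true = ⊥-elim (ℕ.<⇒≱ (ℕ.m<m+n (M ℕ.* M) (ℕ.*-mono-< 0<M 0<M)) (leθ⇒ M M h))

  conj[q-Mθ] : ∀ q M → conj (ι q ⊖ θ· M) ≡ (q , M)
  conj[q-Mθ] q M = ≡-by-coords (re q M) (im q M)
    where
    re : ∀ q M → q + - (- M) + (+ 0 + - M) ≡ q
    re = solve-∀
    im : ∀ q M → - (+ 0 + - M) ≡ M
    im = solve-∀

  norm[q-Mθ] : ∀ q M → norm (ι (+ q) ⊖ θ· + M) ≡ + (q ℕ.* q ℕ.+ q ℕ.* M) - + (M ℕ.* M)
  norm[q-Mθ] q M = trans (norm≡ (+ q) (+ M))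
    (sym (cong₂ _-_ (trans (ℤ.pos-+ (q ℕ.* q) (q ℕ.* M)) (cong₂ _+_ (ℤ.pos-* q q) (ℤ.pos-* q M))) (ℤ.pos-* M M)))
    where
    norm≡ : ∀ q M → (q + - - M) * (q + - - M) + (q + - - M) * (+ 0 + - M) - (+ 0 + - M) * (+ 0 + - M) ≡ q * q + q * M - M * M
    norm≡ = solve-∀

  0<m-n⇒n<m : ∀ m n → + 0 < + m - + n → n ℕ.< m
  0<m-n⇒n<m m n 0<m-n with n ℕ.<? m
  ... | yes n<m = n<m
  ... | no n≮m = ⊥-elim (ℤ.≤⇒≯ (subst (_≤ + 0) (sym (trans (ℤ.[+m]-[+n]≡m⊖n m n) (ℤ.⊖-≤ (ℕ.≮⇒≥ n≮m)))) ℤ.neg-≤-pos) 0<m-n)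

  n<m⇒0<m-n : ∀ m n → n ℕ.< m → + 0 < + m - + n
  n<m⇒0<m-n m n n<m = subst (+ 0 <_) (sym (trans (ℤ.[+m]-[+n]≡m⊖n m n) (ℤ.⊖-≥ (ℕ.<⇒≤ n<m)))) (+<+ (ℕ.m<n⇒0<n∸m n<m))

  positive-conj[q-Mθ] : ∀ q m → Positive (conj (ι (+ q) ⊖ θ· + suc m))
  positive-conj[q-Mθ] q m = subst Positive (sym (conj[q-Mθ] (+ q) (+ suc m))) (positive-coords (+≤+ z≤n) (+≤+ z≤n) (+<+ (ℕ.≤-trans (s≤s z≤n) (ℕ.m≤n+m (suc m) q))))

  leθ⇒positive : ∀ q M → 0 ℕ.< M → leθ q M ≡ true → Positive (θ· + M ⊖ ι (+ q))
  leθ⇒positive q (suc m) _ h = ¬positive-⊝⇒positive (λ ()) (¬positive ∘ subst Positive (⊝-⊖ (θ· + suc m) (ι (+ q))))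
    where
    ¬positive : ¬ Positive (ι (+ q) ⊖ θ· + suc m)
    ¬positive pos = ℕ.<⇒≱ (0<m-n⇒n<m _ _ (subst (+ 0 <_) (norm[q-Mθ] q (suc m)) (positive⇒0<norm pos (positive-conj[q-Mθ] q m))))
      (leθ⇒ q (suc m) h)

  ¬leθ⇒positive : ∀ q M → 0 ℕ.< M → leθ q M ≡ false → Positive (ι (+ q) ⊖ θ· + M)
  ¬leθ⇒positive q (suc m) _ h = 0<norm⇒positive (subst (+ 0 <_) (sym (norm[q-Mθ] q (suc m))) (n<m⇒0<m-n _ _ (¬leθ⇒ q (suc m) h)))
    (positive-conj[q-Mθ] q m)

  module _ (M : ℕ) (0<M : 0 ℕ.< M) where
    private
      floorθ-maximal : leθ (floorθ M) M ≡ true × (floorθ M ≡ M ⊎ leθ (suc (floorθ M)) M ≡ false)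
      floorθ-maximal = count-downClosed (λ q → leθ q M) (leθ-0 M) (leθ-downClosed M) M

    floorθ-lower : Positive (θ· + M ⊖ ι (+ floorθ M))
    floorθ-lower = leθ⇒positive (floorθ M) M 0<M (proj₁ floorθ-maximal)

    floorθ-upper : Positive (ι (+ 1 + + floorθ M) ⊖ θ· + M)
    floorθ-upper with proj₂ floorθ-maximal
    ... | inj₁ floor≡M with () ← trans (sym (leθ-self M 0<M)) (subst (λ q → leθ q M ≡ true) floor≡M (proj₁ floorθ-maximal))
    ... | inj₂ false-above = ¬leθ⇒positive (suc (floorθ M)) M 0<M false-above

    floorθ-unique : ∀ p → Positive (θ· + M ⊖ ι p) → Positive (ι (+ 1 + p) ⊖ θ· + M) → p ≡ + floorθ M
    floorθ-unique p lower upper = ℤ.≤-antisym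
      (positive-ι⇒≤ (subst Positive (gap (+ M) (+ floorθ M) p) (positive-⊕ floorθ-upper lower)))
      (positive-ι⇒≤ (subst Positive (gap (+ M) p (+ floorθ M)) (positive-⊕ upper floorθ-lower)))
      where
      gap : ∀ m a b → (ι (+ 1 + a) ⊖ θ· m) ⊕ (θ· m ⊖ ι b) ≡ ι (+ 1 + a - b)
      gap m a b = ≡-by-coords (re m a b) (im m a b)
        where
        re : ∀ m a b → + 1 + a + - (- m) + (- m + - b) ≡ + 1 + a - b
        re = solve-∀
        im : ∀ m a b → + 0 + - m + (m + - (+ 0)) ≡ + 0
        im = solve-∀

  floorθ-suc : ∀ M → 0 ℕ.< M → floorθ M ℕ.≤ floorθ (suc M) × floorθ (suc M) ℕ.≤ suc (floorθ M)
  floorθ-suc M 0<M =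
    ℤ.drop‿+≤+ (positive-ι⇒≤ (subst Positive (rise (+ M) (+ floorθ M) (+ floorθ (suc M)))
      (positive-⊕ (positive-⊕ (floorθ-upper (suc M) (s≤s z≤n)) (floorθ-lower M 0<M)) positive-θ))) ,
    ℤ.drop‿+≤+ (positive-ι⇒≤ (subst Positive (fall (+ M) (+ floorθ M) (+ floorθ (suc M)))
      (positive-⊕ (positive-⊕ (floorθ-lower (suc M) (s≤s z≤n)) (floorθ-upper M 0<M)) positive-θ²)))
    where
    rise : ∀ m f₀ f₁ → (ι (+ 1 + f₁) ⊖ θ· (+ 1 + m)) ⊕ (θ· m ⊖ ι f₀) ⊕ θ ≡ ι (+ 1 + f₁ - f₀)
    rise m f₀ f₁ = ≡-by-coords (re m f₀ f₁) (im m f₀ f₁)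
      where
      re : ∀ m f₀ f₁ → + 1 + f₁ + - (- (+ 1 + m)) + (- m + - f₀) + - (+ 1) ≡ + 1 + f₁ - f₀
      re = solve-∀
      im : ∀ m f₀ f₁ → + 0 + - (+ 1 + m) + (m + - (+ 0)) + + 1 ≡ + 0
      im = solve-∀
    fall : ∀ m f₀ f₁ → (θ· (+ 1 + m) ⊖ ι f₁) ⊕ (ι (+ 1 + f₀) ⊖ θ· m) ⊕ θ ⊗ θ ≡ ι (+ 1 + (+ 1 + f₀) - f₁)
    fall m f₀ f₁ = ≡-by-coords (re m f₀ f₁) (im m f₀ f₁)
      where
      re : ∀ m f₀ f₁ →
        - (+ 1 + m) + - f₁ + (+ 1 + f₀ + - (- m)) + (- (+ 1) * - (+ 1) + + 1 * + 1) ≡ + 1 + (+ 1 + f₀) - f₁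
      re = solve-∀
      im : ∀ m f₀ f₁ → + 1 + m + - (+ 0) + (+ 0 + - m) + (- (+ 1) * + 1 + + 1 * - (+ 1) + + 1 * + 1) ≡ + 0
      im = solve-∀

  x-y≡z⇒y+z≡x : ∀ {x y z} → x - y ≡ z → y + z ≡ x
  x-y≡z⇒y+z≡x {x} {y} refl = y+[x-y]≡x x y

  x-y-1≡z⇒1+[y+z]≡x : ∀ {x y z} → x - y - + 1 ≡ z → + 1 + (y + z) ≡ x
  x-y-1≡z⇒1+[y+z]≡x {x} {y} refl = lemma x y
    where
    lemma : ∀ x y → + 1 + (y + (x - y - + 1)) ≡ x
    lemma = solve-∀

  -- Shifting by S moves Nθ by the integer T plus δ = Sθ - T ∈ (0, 1); the floor
  -- moves by T, or by T + 1 exactly when the fractional part of (N + S)θ is below δ.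
  module _ (S T : ℕ) (δ>0 : Positive (θ· + S ⊖ ι (+ T))) (δ<1 : Positive (1φ ⊖ (θ· + S ⊖ ι (+ T)))) where

    floorθ-shift : ∀ N → 0 ℕ.< N →
      ¬ Positive ((θ· + S ⊖ ι (+ T)) ⊖ (θ· + (N ℕ.+ S) ⊖ ι (+ floorθ (N ℕ.+ S)))) →
      T ℕ.+ floorθ N ≡ floorθ (N ℕ.+ S)
    floorθ-shift N 0<N@(s≤s _) frac≮δ = ℤ.+-injective (x-y≡z⇒y+z≡x {P} {+ T} (floorθ-unique N 0<N (P - + T) lower upper))
      where
      P = + floorθ (N ℕ.+ S)
      δ frac : ℤφ
      δ = θ· + S ⊖ ι (+ T)
      frac = θ· + (N ℕ.+ S) ⊖ ι P
      lower : Positive (θ· + N ⊖ ι (P - + T))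
      lower = subst Positive frac⊖δ≡ (¬positive-⊝⇒positive frac⊖δ≢0 (frac≮δ ∘ subst Positive (⊝-⊖ frac δ)))
        where
        frac⊖δ≡ : frac ⊖ δ ≡ θ· + N ⊖ ι (P - + T)
        frac⊖δ≡ = shifted (+ N) (+ S) P (+ T)
          where
          shifted : ∀ n s p t → (θ· (n + s) ⊖ ι p) ⊖ (θ· s ⊖ ι t) ≡ θ· n ⊖ ι (p - t)
          shifted n s p t = ≡-by-coords (re n s p t) (im n s p t)
            where
            re : ∀ n s p t → - (n + s) + - p + - (- s + - t) ≡ - n + - (p - t)
            re = solve-∀
            im : ∀ n s p t → n + s + - (+ 0) + - (s + - (+ 0)) ≡ n + - (+ 0)
            im = solve-∀
        frac⊖δ≢0 : frac ⊖ δ ≢ 0φ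
        frac⊖δ≢0 eq with trans (sym frac⊖δ≡) eq
        ... | ()
      upper : Positive (ι (+ 1 + (P - + T)) ⊖ θ· + N)
      upper = subst Positive (shifted (+ N) (+ S) P (+ T)) (positive-⊕ (floorθ-upper (N ℕ.+ S) (ℕ.≤-trans 0<N (ℕ.m≤m+n N S))) δ>0)
        where
        shifted : ∀ n s p t → (ι (+ 1 + p) ⊖ θ· (n + s)) ⊕ (θ· s ⊖ ι t) ≡ ι (+ 1 + (p - t)) ⊖ θ· n
        shifted n s p t = ≡-by-coords (re n s p t) (im n s p t)
          where
          re : ∀ n s p t → + 1 + p + - (- (n + s)) + (- s + - t) ≡ + 1 + (p - t) + - (- n)
          re = solve-∀
          im : ∀ n s p t → + 0 + - (n + s) + (s + - (+ 0)) ≡ + 0 + - n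
          im = solve-∀

    floorθ-shift-carry : ∀ N → 0 ℕ.< N →
      Positive ((θ· + S ⊖ ι (+ T)) ⊖ (θ· + (N ℕ.+ S) ⊖ ι (+ floorθ (N ℕ.+ S)))) →
      suc (T ℕ.+ floorθ N) ≡ floorθ (N ℕ.+ S)
    floorθ-shift-carry N 0<N frac<δ = ℤ.+-injective (x-y-1≡z⇒1+[y+z]≡x {P} {+ T} (floorθ-unique N 0<N (P - + T - + 1) lower upper))
      where
      P = + floorθ (N ℕ.+ S)
      lower : Positive (θ· + N ⊖ ι (P - + T - + 1))
      lower = subst Positive (shifted (+ N) (+ S) P (+ T)) (positive-⊕ (floorθ-lower (N ℕ.+ S) (ℕ.≤-trans 0<N (ℕ.m≤m+n N S))) δ<1)
        where
        shifted : ∀ n s p t → (θ· (n + s) ⊖ ι p) ⊕ (1φ ⊖ (θ· s ⊖ ι t)) ≡ θ· n ⊖ ι (p - t - + 1)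
        shifted n s p t = ≡-by-coords (re n s p t) (im n s p t)
          where
          re : ∀ n s p t → - (n + s) + - p + (+ 1 + - (- s + - t)) ≡ - n + - (p - t - + 1)
          re = solve-∀
          im : ∀ n s p t → n + s + - (+ 0) + (+ 0 + - (s + - (+ 0))) ≡ n + - (+ 0)
          im = solve-∀
      upper : Positive (ι (+ 1 + (P - + T - + 1)) ⊖ θ· + N)
      upper = subst Positive (shifted (+ N) (+ S) P (+ T)) frac<δ
        where
        shifted : ∀ n s p t → (θ· s ⊖ ι t) ⊖ (θ· (n + s) ⊖ ι p) ≡ ι (+ 1 + (p - t - + 1)) ⊖ θ· n
        shifted n s p t = ≡-by-coords (re n s p t) (im n s p t)
          where
          re : ∀ n s p t → - s + - t + - (- (n + s) + - p) ≡ + 1 + (p - t - + 1) + - (- n)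
          re = solve-∀
          im : ∀ n s p t → s + - (+ 0) + - (n + s + - (+ 0)) ≡ + 0 + - n
          im = solve-∀

-- U and V stand for F₂ₙ₋₃ and F₂ₙ₋₂; each name below is the Fibonacci or Lucas
-- number, or the power of φ or θ, that the quantity equals for that choice.
module Quantities (u v : ℤ) where

  open import Data.Integer using (_+_; _*_; -_; _-_)
  open import Data.Product using (_,_)
  open GoldenIntegers using (ℤφ; _⊖_; θ·_; ι)

  F₂ₙ₋₁ F₂ₙ F₂ₙ₊₁ L₂ₙ L₂ₙ₊₂ J cassini : ℤ
  F₂ₙ₋₁ = u + v
  F₂ₙ = u + + 2 * v
  F₂ₙ₊₁ = + 2 * u + + 3 * v
  L₂ₙ = + 3 * u + + 4 * v
  L₂ₙ₊₂ = + 7 * u + + 11 * v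
  J = F₂ₙ * F₂ₙ + F₂ₙ₊₁ * F₂ₙ₊₁ - F₂ₙ₊₁
  cassini = u * u + u * v - v * v - + 1

  φ²ⁿ⁻² φ²ⁿ⁻¹ φ²ⁿ⁺¹ θ²ⁿ⁻³ θ²ⁿ⁻¹ θ²ⁿ⁺¹ φ²-θ²ⁿ⁻² : ℤφ
  φ²ⁿ⁻² = u , v
  φ²ⁿ⁻¹ = v , F₂ₙ₋₁
  φ²ⁿ⁺¹ = F₂ₙ , F₂ₙ₊₁
  θ²ⁿ⁻³ = - v , u
  θ²ⁿ⁻¹ = - F₂ₙ , F₂ₙ₋₁
  θ²ⁿ⁺¹ = θ· F₂ₙ₊₁ ⊖ ι F₂ₙ
  φ²-θ²ⁿ⁻² = + 1 - u - v , v + + 1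

  β α : ℤ → ℤ → ℤ
  β M p = F₂ₙ₊₁ * M - F₂ₙ * (M + p)
  α M p = (F₂ₙ + F₂ₙ₊₁) * M - F₂ₙ₊₁ * (M + p)

  μ : ℤ → ℤ → ℤ → ℤ
  μ j a B = (+ 2 * a + B) * L₂ₙ₊₂ - + 5 * F₂ₙ₊₁ * (j + a)

  -- The lattice point of the first carry, at M⋆ = L₂ₙ J + 1.
  m⋆ a⋆ B⋆ M⋆ p⋆ : ℤ
  m⋆ = + 2 * F₂ₙ + F₂ₙ₊₁ - + 2
  a⋆ = m⋆ * F₂ₙ₋₁ + u - + 1
  B⋆ = m⋆ * F₂ₙ + v + + 2
  M⋆ = F₂ₙ * a⋆ + F₂ₙ₊₁ * B⋆
  p⋆ = F₂ₙ * B⋆ + F₂ₙ₊₁ * a⋆ - F₂ₙ * a⋆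

module Identities (u v : ℤ) (cassini≡0 : Quantities.cassini u v ≡ + 0) where
  open import Data.Integer using (_+_; _*_; -_; _-_)
  import Data.Integer.Properties as ℤ
  open import Data.Integer.Tactic.RingSolver using (solve-∀)
  open import Data.Product using (_×_; _,_; proj₁; proj₂)
  open import Relation.Binary.PropositionalEquality using (sym; trans; cong; subst)
  open GoldenIntegers
  open Quantities u v


  ≡-mod-cassini : ∀ {x y : ℤ} k → x ≡ y + k * cassini → x ≡ y
  ≡-mod-cassini {x} {y} k x≡y+kC = trans x≡y+kC (trans (cong (λ c → y + k * c) cassini≡0)
    (trans (cong (_+_ y) (ℤ.*-zeroʳ k)) (ℤ.+-identityʳ y)))

  θ²ⁿ⁺¹⊗φ²ⁿ⁺¹ : θ²ⁿ⁺¹ ⊗ φ²ⁿ⁺¹ ≡ 1φ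
  θ²ⁿ⁺¹⊗φ²ⁿ⁺¹ = ≡-by-coords (≡-mod-cassini (+ 1) (re u v)) (im u v)
    where
    re : ∀ u v →
      let F₂ₙ = u + + 2 * v
          F₂ₙ₊₁ = + 2 * u + + 3 * v
          cassini = u * u + u * v - v * v - + 1
      in (- F₂ₙ₊₁ + - F₂ₙ) * F₂ₙ + (F₂ₙ₊₁ + - (+ 0)) * F₂ₙ₊₁ ≡ + 1 + (+ 1) * cassini
    re = solve-∀
    im : ∀ u v →
      let F₂ₙ = u + + 2 * v
          F₂ₙ₊₁ = + 2 * u + + 3 * v
      in (- F₂ₙ₊₁ + - F₂ₙ) * F₂ₙ₊₁ + (F₂ₙ₊₁ + - (+ 0)) * F₂ₙ + (F₂ₙ₊₁ + - (+ 0)) * F₂ₙ₊₁ ≡ + 0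
    im = solve-∀

  θ²ⁿ⁻¹⊗φ²ⁿ⁻¹ : θ²ⁿ⁻¹ ⊗ φ²ⁿ⁻¹ ≡ 1φ
  θ²ⁿ⁻¹⊗φ²ⁿ⁻¹ = ≡-by-coords (≡-mod-cassini (+ 1) (re u v)) (im u v)
    where
    re : ∀ u v →
      let F₂ₙ₋₁ = u + v
          F₂ₙ = u + + 2 * v
          cassini = u * u + u * v - v * v - + 1
      in - F₂ₙ * v + F₂ₙ₋₁ * F₂ₙ₋₁ ≡ + 1 + (+ 1) * cassini
    re = solve-∀
    im : ∀ u v →
      let F₂ₙ₋₁ = u + v
          F₂ₙ = u + + 2 * v
      in - F₂ₙ * F₂ₙ₋₁ + F₂ₙ₋₁ * v + F₂ₙ₋₁ * F₂ₙ₋₁ ≡ + 0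
    im = solve-∀

  θ²ⁿ⁻³⊗φ²ⁿ⁻² : θ²ⁿ⁻³ ⊗ φ²ⁿ⁻² ≡ (+ 0 , + 1)
  θ²ⁿ⁻³⊗φ²ⁿ⁻² = ≡-by-coords (re u v) (≡-mod-cassini (+ 1) (im u v))
    where
    re : ∀ u v → - v * u + u * v ≡ + 0
    re = solve-∀
    im : ∀ u v →
      let cassini = u * u + u * v - v * v - + 1
      in - v * v + u * u + u * v ≡ + 1 + (+ 1) * cassini
    im = solve-∀

  [1-θ²ⁿ⁺¹]⊗φ²ⁿ⁺¹ : (1φ ⊖ θ²ⁿ⁺¹) ⊗ φ²ⁿ⁺¹ ≡ (F₂ₙ - + 1 , F₂ₙ₊₁)
  [1-θ²ⁿ⁺¹]⊗φ²ⁿ⁺¹ = ≡-by-coords (≡-mod-cassini (- + 1) (re u v)) (im u v)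
    where
    re : ∀ u v →
      let F₂ₙ = u + + 2 * v
          F₂ₙ₊₁ = + 2 * u + + 3 * v
          cassini = u * u + u * v - v * v - + 1
      in (+ 1 + - (- F₂ₙ₊₁ + - F₂ₙ)) * F₂ₙ + (+ 0 + - (F₂ₙ₊₁ + - (+ 0))) * F₂ₙ₊₁ ≡ F₂ₙ - + 1 + (- + 1) * cassini
    re = solve-∀
    im : ∀ u v →
      let F₂ₙ = u + + 2 * v
          F₂ₙ₊₁ = + 2 * u + + 3 * v
      in (+ 1 + - (- F₂ₙ₊₁ + - F₂ₙ)) * F₂ₙ₊₁ + (+ 0 + - (F₂ₙ₊₁ + - (+ 0))) * F₂ₙ + (+ 0 + - (F₂ₙ₊₁ + - (+ 0))) * F₂ₙ₊₁ ≡ F₂ₙ₊₁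
    im = solve-∀

  [θ-θ²ⁿ⁺¹]⊗φ²ⁿ⁺¹ : (θ ⊖ θ²ⁿ⁺¹) ⊗ φ²ⁿ⁺¹ ≡ (F₂ₙ₋₁ - + 1 , F₂ₙ)
  [θ-θ²ⁿ⁺¹]⊗φ²ⁿ⁺¹ = ≡-by-coords (≡-mod-cassini (- + 1) (re u v)) (im u v)
    where
    re : ∀ u v →
      let F₂ₙ₋₁ = u + v
          F₂ₙ = u + + 2 * v
          F₂ₙ₊₁ = + 2 * u + + 3 * v
          cassini = u * u + u * v - v * v - + 1
      in (- (+ 1) + - (- F₂ₙ₊₁ + - F₂ₙ)) * F₂ₙ + (+ 1 + - (F₂ₙ₊₁ + - (+ 0))) * F₂ₙ₊₁ ≡ F₂ₙ₋₁ - + 1 + (- + 1) * cassini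
    re = solve-∀
    im : ∀ u v →
      let F₂ₙ = u + + 2 * v
          F₂ₙ₊₁ = + 2 * u + + 3 * v
      in (- (+ 1) + - (- F₂ₙ₊₁ + - F₂ₙ)) * F₂ₙ₊₁ + (+ 1 + - (F₂ₙ₊₁ + - (+ 0))) * F₂ₙ + (+ 1 + - (F₂ₙ₊₁ + - (+ 0))) * F₂ₙ₊₁ ≡ F₂ₙ
    im = solve-∀

  [φ²-θ²ⁿ⁻²]⊗φ²ⁿ⁻² : φ²-θ²ⁿ⁻² ⊗ φ²ⁿ⁻² ≡ (F₂ₙ₋₁ - + 1 , F₂ₙ)
  [φ²-θ²ⁿ⁻²]⊗φ²ⁿ⁻² = ≡-by-coords (≡-mod-cassini (- + 1) (re u v)) (im u v)
    where
    re : ∀ u v →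
      let F₂ₙ₋₁ = u + v
          cassini = u * u + u * v - v * v - + 1
      in (+ 1 - u - v) * u + (v + + 1) * v ≡ F₂ₙ₋₁ - + 1 + (- + 1) * cassini
    re = solve-∀
    im : ∀ u v →
      let F₂ₙ = u + + 2 * v
      in (+ 1 - u - v) * v + (v + + 1) * u + (v + + 1) * v ≡ F₂ₙ
    im = solve-∀

  φ²ⁿ⁺¹⊗[Mθ-p] : ∀ M p → φ²ⁿ⁺¹ ⊗ (θ· M ⊖ ι p) ≡ (β M p , α M p)
  φ²ⁿ⁺¹⊗[Mθ-p] M p = ≡-by-coords (re u v M p) (im u v M p)
    where
    re : ∀ u v M p →
      let F₂ₙ = u + + 2 * v
          F₂ₙ₊₁ = + 2 * u + + 3 * v
          β = F₂ₙ₊₁ * M - F₂ₙ * (M + p)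
      in F₂ₙ * (- M + - p) + F₂ₙ₊₁ * (M + - (+ 0)) ≡ β
    re = solve-∀
    im : ∀ u v M p →
      let F₂ₙ = u + + 2 * v
          F₂ₙ₊₁ = + 2 * u + + 3 * v
          α = (F₂ₙ + F₂ₙ₊₁) * M - F₂ₙ₊₁ * (M + p)
      in F₂ₙ * (M + - (+ 0)) + F₂ₙ₊₁ * (- M + - p) + F₂ₙ₊₁ * (M + - (+ 0)) ≡ α
    im = solve-∀

  φ²ⁿ⁺¹⊗[θ²ⁿ⁺¹-[Mθ-p]] : ∀ M p → φ²ⁿ⁺¹ ⊗ (θ²ⁿ⁺¹ ⊖ (θ· M ⊖ ι p)) ≡ (+ 1 - β M p , - α M p)
  φ²ⁿ⁺¹⊗[θ²ⁿ⁺¹-[Mθ-p]] M p = ≡-by-coords (≡-mod-cassini (+ 1) (re u v M p)) (im u v M p)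
    where
    re : ∀ u v M p →
      let F₂ₙ = u + + 2 * v
          F₂ₙ₊₁ = + 2 * u + + 3 * v
          cassini = u * u + u * v - v * v - + 1
          β = F₂ₙ₊₁ * M - F₂ₙ * (M + p)
      in F₂ₙ * (- F₂ₙ₊₁ + - F₂ₙ + - (- M + - p)) + F₂ₙ₊₁ * (F₂ₙ₊₁ + - (+ 0) + - (M + - (+ 0))) ≡ + 1 - β + (+ 1) * cassini
    re = solve-∀
    im : ∀ u v M p →
      let F₂ₙ = u + + 2 * v
          F₂ₙ₊₁ = + 2 * u + + 3 * v
          α = (F₂ₙ + F₂ₙ₊₁) * M - F₂ₙ₊₁ * (M + p)
      in F₂ₙ * (F₂ₙ₊₁ + - (+ 0) + - (M + - (+ 0))) + F₂ₙ₊₁ * (- F₂ₙ₊₁ + - F₂ₙ + - (- M + - p)) + F₂ₙ₊₁ * (F₂ₙ₊₁ + - (+ 0) + - (M + - (+ 0))) ≡ - α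
    im = solve-∀

  [p+Mφ]⊗θ²ⁿ⁺¹ : ∀ M p → (p , M) ⊗ θ²ⁿ⁺¹ ≡ (β M p + α M p , - α M p)
  [p+Mφ]⊗θ²ⁿ⁺¹ M p = ≡-by-coords (re u v M p) (im u v M p)
    where
    re : ∀ u v M p →
      let F₂ₙ = u + + 2 * v
          F₂ₙ₊₁ = + 2 * u + + 3 * v
          β = F₂ₙ₊₁ * M - F₂ₙ * (M + p)
          α = (F₂ₙ + F₂ₙ₊₁) * M - F₂ₙ₊₁ * (M + p)
      in p * (- F₂ₙ₊₁ + - F₂ₙ) + M * (F₂ₙ₊₁ + - (+ 0)) ≡ β + α
    re = solve-∀
    im : ∀ u v M p →
      let F₂ₙ = u + + 2 * v
          F₂ₙ₊₁ = + 2 * u + + 3 * v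
          α = (F₂ₙ + F₂ₙ₊₁) * M - F₂ₙ₊₁ * (M + p)
      in p * (F₂ₙ₊₁ + - (+ 0)) + M * (- F₂ₙ₊₁ + - F₂ₙ) + M * (F₂ₙ₊₁ + - (+ 0)) ≡ - α
    im = solve-∀

  M≡F₂ₙa+F₂ₙ₊₁B : ∀ M p → M ≡ F₂ₙ * - α M p + F₂ₙ₊₁ * β M p
  M≡F₂ₙa+F₂ₙ₊₁B M p = ≡-mod-cassini (- M) (identity u v M p)
    where
    identity : ∀ u v M p →
      let F₂ₙ = u + + 2 * v
          F₂ₙ₊₁ = + 2 * u + + 3 * v
          cassini = u * u + u * v - v * v - + 1
          β = F₂ₙ₊₁ * M - F₂ₙ * (M + p)
          α = (F₂ₙ + F₂ₙ₊₁) * M - F₂ₙ₊₁ * (M + p)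
      in M ≡ F₂ₙ * - α + F₂ₙ₊₁ * β + (- M) * cassini
    identity = solve-∀

  -- Solving F₂ₙ a + F₂ₙ₊₁ B = L₂ₙ j + c for (B, j), with m = μ j a B as the new unknown.
  general-solution : ∀ j c a B → L₂ₙ * j + c ≡ F₂ₙ * a + F₂ₙ₊₁ * B →
    B ≡ L₂ₙ * μ j a B - + 5 * F₂ₙ₊₁ * c - + 2 * a × j ≡ F₂ₙ₊₁ * μ j a B - a - c * L₂ₙ₊₂
  general-solution j c a B h =
    subst (λ c → B ≡ L₂ₙ * μ j a B - + 5 * F₂ₙ₊₁ * c - + 2 * a) c≡ (≡-mod-cassini (- (B + + 2 * a)) (B≡ u v j a B)) ,
    subst (λ c → j ≡ F₂ₙ₊₁ * μ j a B - a - c * L₂ₙ₊₂) c≡ (≡-mod-cassini (- (a + j)) (j≡ u v j a B))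
    where
    c≡ : F₂ₙ * a + F₂ₙ₊₁ * B - L₂ₙ * j ≡ c
    c≡ = trans (cong (λ x → x - L₂ₙ * j) (sym h)) (x+c-x≡c (L₂ₙ * j) c)
      where
      x+c-x≡c : ∀ x c → x + c - x ≡ c
      x+c-x≡c = solve-∀
    B≡ : ∀ u v j a B →
      let F₂ₙ = u + + 2 * v
          F₂ₙ₊₁ = + 2 * u + + 3 * v
          L₂ₙ = + 3 * u + + 4 * v
          L₂ₙ₊₂ = + 7 * u + + 11 * v
          cassini = u * u + u * v - v * v - + 1
          μ = (+ 2 * a + B) * L₂ₙ₊₂ - + 5 * F₂ₙ₊₁ * (j + a)
      in B ≡ L₂ₙ * μ - + 5 * F₂ₙ₊₁ * (F₂ₙ * a + F₂ₙ₊₁ * B - L₂ₙ * j) - + 2 * a + (- (B + + 2 * a)) * cassini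
    B≡ = solve-∀
    j≡ : ∀ u v j a B →
      let F₂ₙ = u + + 2 * v
          F₂ₙ₊₁ = + 2 * u + + 3 * v
          L₂ₙ = + 3 * u + + 4 * v
          L₂ₙ₊₂ = + 7 * u + + 11 * v
          cassini = u * u + u * v - v * v - + 1
          μ = (+ 2 * a + B) * L₂ₙ₊₂ - + 5 * F₂ₙ₊₁ * (j + a)
      in j ≡ F₂ₙ₊₁ * μ - a - (F₂ₙ * a + F₂ₙ₊₁ * B - L₂ₙ * j) * L₂ₙ₊₂ + (- (a + j)) * cassini
    j≡ = solve-∀

  general-solution₀ : ∀ j a B → L₂ₙ * j ≡ F₂ₙ * a + F₂ₙ₊₁ * B →
    B ≡ L₂ₙ * μ j a B - + 2 * a × j ≡ F₂ₙ₊₁ * μ j a B - a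
  general-solution₀ j a B h =
    trans (proj₁ solution) (c≡0₁ (L₂ₙ * μ j a B) (+ 5 * F₂ₙ₊₁) a) ,
    trans (proj₂ solution) (c≡0₂ (F₂ₙ₊₁ * μ j a B) a L₂ₙ₊₂)
    where
    solution = general-solution j (+ 0) a B (trans (ℤ.+-identityʳ _) h)
    c≡0₁ : ∀ x y a → x - y * + 0 - + 2 * a ≡ x - + 2 * a
    c≡0₁ = solve-∀
    c≡0₂ : ∀ x a k → x - a - + 0 * k ≡ x - a
    c≡0₂ = solve-∀

  general-solution₁ : ∀ j a B → L₂ₙ * j + + 1 ≡ F₂ₙ * a + F₂ₙ₊₁ * B →
    B ≡ L₂ₙ * μ j a B - + 5 * F₂ₙ₊₁ - + 2 * a × j ≡ F₂ₙ₊₁ * μ j a B - a - L₂ₙ₊₂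
  general-solution₁ j a B h =
    trans (proj₁ solution) (c≡1₁ (L₂ₙ * μ j a B) (+ 5 * F₂ₙ₊₁) a) ,
    trans (proj₂ solution) (c≡1₂ (F₂ₙ₊₁ * μ j a B) a L₂ₙ₊₂)
    where
    solution = general-solution j (+ 1) a B h
    c≡1₁ : ∀ x y a → x - y * + 1 - + 2 * a ≡ x - y - + 2 * a
    c≡1₁ = solve-∀
    c≡1₂ : ∀ x a k → x - a - + 1 * k ≡ x - a - k
    c≡1₂ = solve-∀

  [Lm-2a-aφ]⊕[2a+aφ] : ∀ m a → (L₂ₙ * m - + 2 * a , - a) ⊕ (+ 2 * a , a) ≡ ι m ⊗ ι L₂ₙ
  [Lm-2a-aφ]⊕[2a+aφ] m a = ≡-by-coords (re u v m a) (im u v m a)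
    where
    re : ∀ u v m a →
      let L₂ₙ = + 3 * u + + 4 * v
      in L₂ₙ * m - + 2 * a + + 2 * a ≡ m * L₂ₙ + + 0 * + 0
    re = solve-∀
    im : ∀ u v m a →
      let L₂ₙ = + 3 * u + + 4 * v
      in - a + a ≡ m * + 0 + + 0 * L₂ₙ + + 0 * + 0
    im = solve-∀

  module _ (m a : ℤ) where
    private
      t₀ : ℤ
      t₀ = m * F₂ₙ₋₁ - a

    ⊝[B-aφ]₀ : ⊝ (L₂ₙ * m - + 2 * a , - a) ≡ ι m ⊗ θ²ⁿ⁻¹ ⊕ (- t₀ * + 2 , - t₀)
    ⊝[B-aφ]₀ = ≡-by-coords (re u v m a) (im u v m a)
      where
      re : ∀ u v m a →
        let F₂ₙ₋₁ = u + v
            F₂ₙ = u + + 2 * v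
            L₂ₙ = + 3 * u + + 4 * v
            t₀ = m * F₂ₙ₋₁ - a
        in - (L₂ₙ * m - + 2 * a) ≡ m * - F₂ₙ + + 0 * F₂ₙ₋₁ + - t₀ * + 2
      re = solve-∀
      im : ∀ u v m a →
        let F₂ₙ₋₁ = u + v
            F₂ₙ = u + + 2 * v
            t₀ = m * F₂ₙ₋₁ - a
        in - (- a) ≡ m * F₂ₙ₋₁ + + 0 * - F₂ₙ + + 0 * F₂ₙ₋₁ + - t₀
      im = solve-∀

    [1-B+aφ]₀ : ((+ 1 - (L₂ₙ * m - + 2 * a) , a) ⊕ ((t₀ - + 1) * + 2 , t₀ - + 1)) ⊗ φ²ⁿ⁻¹ ⊕ θ²ⁿ⁺¹
                ≡ ι (m - + 2 * F₂ₙ - F₂ₙ₊₁)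
    [1-B+aφ]₀ = ≡-by-coords (≡-mod-cassini m (re u v m a)) (im u v m a)
      where
      re : ∀ u v m a →
        let F₂ₙ₋₁ = u + v
            F₂ₙ = u + + 2 * v
            F₂ₙ₊₁ = + 2 * u + + 3 * v
            L₂ₙ = + 3 * u + + 4 * v
            cassini = u * u + u * v - v * v - + 1
            t₀ = m * F₂ₙ₋₁ - a
        in (+ 1 - (L₂ₙ * m - + 2 * a) + (t₀ - + 1) * + 2) * v + (a + (t₀ - + 1)) * F₂ₙ₋₁ + (- F₂ₙ₊₁ + - F₂ₙ) ≡ m - + 2 * F₂ₙ - F₂ₙ₊₁ + m * cassini
      re = solve-∀
      im : ∀ u v m a →
        let F₂ₙ₋₁ = u + v
            F₂ₙ₊₁ = + 2 * u + + 3 * v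
            L₂ₙ = + 3 * u + + 4 * v
            t₀ = m * F₂ₙ₋₁ - a
        in (+ 1 - (L₂ₙ * m - + 2 * a) + (t₀ - + 1) * + 2) * F₂ₙ₋₁ + (a + (t₀ - + 1)) * v + (a + (t₀ - + 1)) * F₂ₙ₋₁ + (F₂ₙ₊₁ + - (+ 0)) ≡ + 0
      im = solve-∀

    j-J₀ : F₂ₙ₊₁ * m - a - J ≡ F₂ₙ + F₂ₙ₊₁ + F₂ₙ * (m - + 2 * F₂ₙ - F₂ₙ₊₁ - + 1) + (t₀ - + 1)
    j-J₀ = ≡-mod-cassini (- + 1) (identity u v m a)
      where
      identity : ∀ u v m a →
        let F₂ₙ₋₁ = u + v
            F₂ₙ = u + + 2 * v
            F₂ₙ₊₁ = + 2 * u + + 3 * v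
            J = F₂ₙ * F₂ₙ + F₂ₙ₊₁ * F₂ₙ₊₁ - F₂ₙ₊₁
            cassini = u * u + u * v - v * v - + 1
            t₀ = m * F₂ₙ₋₁ - a
        in F₂ₙ₊₁ * m - a - J ≡ F₂ₙ + F₂ₙ₊₁ + F₂ₙ * (m - + 2 * F₂ₙ - F₂ₙ₊₁ - + 1) + (t₀ - + 1) + (- + 1) * cassini
      identity = solve-∀

  module _ (m a : ℤ) where
    private
      t₁ : ℤ
      t₁ = (m - + 4) * F₂ₙ₋₁ + u - a

    ⊝[1-B+aφ]₁ : ⊝ (+ 1 - (L₂ₙ * m - + 5 * F₂ₙ₊₁ - + 2 * a) , a)
                 ≡ φ²-θ²ⁿ⁻² ⊕ ((t₁ - + 1) * + 2 , t₁ - + 1) ⊕ ι (- (m - + 4) - + 1) ⊗ θ²ⁿ⁻¹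
    ⊝[1-B+aφ]₁ = ≡-by-coords (re u v m a) (im u v m a)
      where
      re : ∀ u v m a →
        let F₂ₙ₋₁ = u + v
            F₂ₙ = u + + 2 * v
            F₂ₙ₊₁ = + 2 * u + + 3 * v
            L₂ₙ = + 3 * u + + 4 * v
            t₁ = (m - + 4) * F₂ₙ₋₁ + u - a
        in - (+ 1 - (L₂ₙ * m - + 5 * F₂ₙ₊₁ - + 2 * a)) ≡ + 1 - u - v + (t₁ - + 1) * + 2 + ((- (m - + 4) - + 1) * - F₂ₙ + + 0 * F₂ₙ₋₁)
      re = solve-∀
      im : ∀ u v m a →
        let F₂ₙ₋₁ = u + v
            F₂ₙ = u + + 2 * v
            t₁ = (m - + 4) * F₂ₙ₋₁ + u - a
        in - a ≡ v + + 1 + (t₁ - + 1) + ((- (m - + 4) - + 1) * F₂ₙ₋₁ + + 0 * - F₂ₙ + + 0 * F₂ₙ₋₁)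
      im = solve-∀

    -j₁ : - (F₂ₙ₊₁ * m - a - L₂ₙ₊₂) ≡ F₂ₙ₋₁ + (- (m - + 4) - + 1) * F₂ₙ + - t₁
    -j₁ = identity u v m a
      where
      identity : ∀ u v m a →
        let F₂ₙ₋₁ = u + v
            F₂ₙ = u + + 2 * v
            F₂ₙ₊₁ = + 2 * u + + 3 * v
            L₂ₙ₊₂ = + 7 * u + + 11 * v
            t₁ = (m - + 4) * F₂ₙ₋₁ + u - a
        in - (F₂ₙ₊₁ * m - a - L₂ₙ₊₂) ≡ F₂ₙ₋₁ + (- (m - + 4) - + 1) * F₂ₙ + - t₁
      identity = solve-∀

    ⊝[B-aφ]₁ : ⊝ (L₂ₙ * m - + 5 * F₂ₙ₊₁ - + 2 * a , - a) ≡ θ²ⁿ⁻³ ⊕ (- t₁ * + 2 , - t₁) ⊕ ι (m - + 4) ⊗ θ²ⁿ⁻¹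
    ⊝[B-aφ]₁ = ≡-by-coords (re u v m a) (im u v m a)
      where
      re : ∀ u v m a →
        let F₂ₙ₋₁ = u + v
            F₂ₙ = u + + 2 * v
            F₂ₙ₊₁ = + 2 * u + + 3 * v
            L₂ₙ = + 3 * u + + 4 * v
            t₁ = (m - + 4) * F₂ₙ₋₁ + u - a
        in - (L₂ₙ * m - + 5 * F₂ₙ₊₁ - + 2 * a) ≡ - v + - t₁ * + 2 + ((m - + 4) * - F₂ₙ + + 0 * F₂ₙ₋₁)
      re = solve-∀
      im : ∀ u v m a →
        let F₂ₙ₋₁ = u + v
            F₂ₙ = u + + 2 * v
            t₁ = (m - + 4) * F₂ₙ₋₁ + u - a
        in - (- a) ≡ u + - t₁ + ((m - + 4) * F₂ₙ₋₁ + + 0 * - F₂ₙ + + 0 * F₂ₙ₋₁)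
      im = solve-∀

    [1-B+aφ]₁ : ((+ 1 - (L₂ₙ * m - + 5 * F₂ₙ₊₁ - + 2 * a) , a) ⊕ ((t₁ - + 1) * + 2 , t₁ - + 1)) ⊗ φ²ⁿ⁻¹ ⊕ θ²ⁿ⁺¹ ⊕ θ ⊗ θ
                ≡ ι (m - + 1 - + 2 * F₂ₙ - F₂ₙ₊₁)
    [1-B+aφ]₁ = ≡-by-coords (≡-mod-cassini (m - + 3) (re u v m a)) (≡-mod-cassini (+ 1) (im u v m a))
      where
      re : ∀ u v m a →
        let F₂ₙ₋₁ = u + v
            F₂ₙ = u + + 2 * v
            F₂ₙ₊₁ = + 2 * u + + 3 * v
            L₂ₙ = + 3 * u + + 4 * v
            cassini = u * u + u * v - v * v - + 1
            t₁ = (m - + 4) * F₂ₙ₋₁ + u - a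
        in (+ 1 - (L₂ₙ * m - + 5 * F₂ₙ₊₁ - + 2 * a) + (t₁ - + 1) * + 2) * v + (a + (t₁ - + 1)) * F₂ₙ₋₁ + (- F₂ₙ₊₁ + - F₂ₙ) + (- (+ 1) * - (+ 1) + + 1 * + 1) ≡ m - + 1 - + 2 * F₂ₙ - F₂ₙ₊₁ + (m - + 3) * cassini
      re = solve-∀
      im : ∀ u v m a →
        let F₂ₙ₋₁ = u + v
            F₂ₙ₊₁ = + 2 * u + + 3 * v
            L₂ₙ = + 3 * u + + 4 * v
            cassini = u * u + u * v - v * v - + 1
            t₁ = (m - + 4) * F₂ₙ₋₁ + u - a
        in (+ 1 - (L₂ₙ * m - + 5 * F₂ₙ₊₁ - + 2 * a) + (t₁ - + 1) * + 2) * F₂ₙ₋₁ + (a + (t₁ - + 1)) * v + (a + (t₁ - + 1)) * F₂ₙ₋₁ + (F₂ₙ₊₁ + - (+ 0)) + (- (+ 1) * + 1 + + 1 * - (+ 1) + + 1 * + 1) ≡ + 0 + (+ 1) * cassini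
      im = solve-∀

    j-J₁ : F₂ₙ₊₁ * m - a - L₂ₙ₊₂ - J ≡ F₂ₙ * (m - + 2 - + 2 * F₂ₙ - F₂ₙ₊₁) + (t₁ - + 1)
    j-J₁ = ≡-mod-cassini (- + 1) (identity u v m a)
      where
      identity : ∀ u v m a →
        let F₂ₙ₋₁ = u + v
            F₂ₙ = u + + 2 * v
            F₂ₙ₊₁ = + 2 * u + + 3 * v
            L₂ₙ₊₂ = + 7 * u + + 11 * v
            J = F₂ₙ * F₂ₙ + F₂ₙ₊₁ * F₂ₙ₊₁ - F₂ₙ₊₁
            cassini = u * u + u * v - v * v - + 1
            t₁ = (m - + 4) * F₂ₙ₋₁ + u - a
        in F₂ₙ₊₁ * m - a - L₂ₙ₊₂ - J ≡ F₂ₙ * (m - + 2 - + 2 * F₂ₙ - F₂ₙ₊₁) + (t₁ - + 1) + (- + 1) * cassini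
      identity = solve-∀

  [B⋆-a⋆φ]⊗φ²ⁿ⁻¹ : (B⋆ , - a⋆) ⊗ φ²ⁿ⁻¹ ≡ ι (L₂ₙ - + 1) ⊗ θ
  [B⋆-a⋆φ]⊗φ²ⁿ⁻¹ = ≡-by-coords (≡-mod-cassini (+ 1 - + 4 * u - + 7 * v) (re u v)) (≡-mod-cassini (- + 1) (im u v))
    where
    re : ∀ u v →
      let F₂ₙ₋₁ = u + v
          F₂ₙ = u + + 2 * v
          F₂ₙ₊₁ = + 2 * u + + 3 * v
          L₂ₙ = + 3 * u + + 4 * v
          cassini = u * u + u * v - v * v - + 1
          m⋆ = + 2 * F₂ₙ + F₂ₙ₊₁ - + 2
          a⋆ = m⋆ * F₂ₙ₋₁ + u - + 1
          B⋆ = m⋆ * F₂ₙ + v + + 2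
      in B⋆ * v + - a⋆ * F₂ₙ₋₁ ≡ (L₂ₙ - + 1) * - (+ 1) + + 0 * + 1 + (+ 1 - + 4 * u - + 7 * v) * cassini
    re = solve-∀
    im : ∀ u v →
      let F₂ₙ₋₁ = u + v
          F₂ₙ = u + + 2 * v
          F₂ₙ₊₁ = + 2 * u + + 3 * v
          L₂ₙ = + 3 * u + + 4 * v
          cassini = u * u + u * v - v * v - + 1
          m⋆ = + 2 * F₂ₙ + F₂ₙ₊₁ - + 2
          a⋆ = m⋆ * F₂ₙ₋₁ + u - + 1
          B⋆ = m⋆ * F₂ₙ + v + + 2
      in B⋆ * F₂ₙ₋₁ + - a⋆ * v + - a⋆ * F₂ₙ₋₁ ≡ (L₂ₙ - + 1) * + 1 + + 0 * - (+ 1) + + 0 * + 1 + (- + 1) * cassini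
    im = solve-∀

  [1-B⋆+a⋆φ]⊗φ²ⁿ⁻¹ : (+ 1 - B⋆ , a⋆) ⊗ φ²ⁿ⁻¹ ≡ θ ⊖ θ²ⁿ⁺¹
  [1-B⋆+a⋆φ]⊗φ²ⁿ⁻¹ = ≡-by-coords (≡-mod-cassini (- + 1 + + 4 * u + + 7 * v) (re u v)) (≡-mod-cassini (+ 1) (im u v))
    where
    re : ∀ u v →
      let F₂ₙ₋₁ = u + v
          F₂ₙ = u + + 2 * v
          F₂ₙ₊₁ = + 2 * u + + 3 * v
          cassini = u * u + u * v - v * v - + 1
          m⋆ = + 2 * F₂ₙ + F₂ₙ₊₁ - + 2
          a⋆ = m⋆ * F₂ₙ₋₁ + u - + 1
          B⋆ = m⋆ * F₂ₙ + v + + 2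
      in (+ 1 - B⋆) * v + a⋆ * F₂ₙ₋₁ ≡ - (+ 1) + - (- F₂ₙ₊₁ + - F₂ₙ) + (- + 1 + + 4 * u + + 7 * v) * cassini
    re = solve-∀
    im : ∀ u v →
      let F₂ₙ₋₁ = u + v
          F₂ₙ = u + + 2 * v
          F₂ₙ₊₁ = + 2 * u + + 3 * v
          cassini = u * u + u * v - v * v - + 1
          m⋆ = + 2 * F₂ₙ + F₂ₙ₊₁ - + 2
          a⋆ = m⋆ * F₂ₙ₋₁ + u - + 1
          B⋆ = m⋆ * F₂ₙ + v + + 2
      in (+ 1 - B⋆) * F₂ₙ₋₁ + a⋆ * v + a⋆ * F₂ₙ₋₁ ≡ + 1 + - (F₂ₙ₊₁ + - (+ 0)) + (+ 1) * cassini
    im = solve-∀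

  M⋆≡ : M⋆ ≡ L₂ₙ * J + + 1
  M⋆≡ = ≡-mod-cassini (+ 1 - + 3 * u - + 4 * v) (identity u v)
    where
    identity : ∀ u v →
      let F₂ₙ₋₁ = u + v
          F₂ₙ = u + + 2 * v
          F₂ₙ₊₁ = + 2 * u + + 3 * v
          L₂ₙ = + 3 * u + + 4 * v
          J = F₂ₙ * F₂ₙ + F₂ₙ₊₁ * F₂ₙ₊₁ - F₂ₙ₊₁
          cassini = u * u + u * v - v * v - + 1
          m⋆ = + 2 * F₂ₙ + F₂ₙ₊₁ - + 2
          a⋆ = m⋆ * F₂ₙ₋₁ + u - + 1
          B⋆ = m⋆ * F₂ₙ + v + + 2
      in F₂ₙ * a⋆ + F₂ₙ₊₁ * B⋆ ≡ L₂ₙ * J + + 1 + (+ 1 - + 3 * u - + 4 * v) * cassini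
    identity = solve-∀

  Mθ-p≡[B-aφ]θ²ⁿ⁺¹ : ∀ a B → θ· (F₂ₙ * a + F₂ₙ₊₁ * B) ⊖ ι (F₂ₙ * B + F₂ₙ₊₁ * a - F₂ₙ * a) ≡ (B , - a) ⊗ θ²ⁿ⁺¹
  Mθ-p≡[B-aφ]θ²ⁿ⁺¹ a B = ≡-by-coords (re u v a B) (im u v a B)
    where
    re : ∀ u v a B →
      let F₂ₙ = u + + 2 * v
          F₂ₙ₊₁ = + 2 * u + + 3 * v
      in - (F₂ₙ * a + F₂ₙ₊₁ * B) + - (F₂ₙ * B + F₂ₙ₊₁ * a - F₂ₙ * a) ≡ B * (- F₂ₙ₊₁ + - F₂ₙ) + - a * (F₂ₙ₊₁ + - (+ 0))
    re = solve-∀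
    im : ∀ u v a B →
      let F₂ₙ = u + + 2 * v
          F₂ₙ₊₁ = + 2 * u + + 3 * v
      in F₂ₙ * a + F₂ₙ₊₁ * B + - (+ 0) ≡ B * (F₂ₙ₊₁ + - (+ 0)) + - a * (- F₂ₙ₊₁ + - F₂ₙ) + - a * (F₂ₙ₊₁ + - (+ 0))
    im = solve-∀

  θ²ⁿ⁺¹-[Mθ-p]≡[1-B+aφ]θ²ⁿ⁺¹ : ∀ a B →
    θ²ⁿ⁺¹ ⊖ (θ· (F₂ₙ * a + F₂ₙ₊₁ * B) ⊖ ι (F₂ₙ * B + F₂ₙ₊₁ * a - F₂ₙ * a)) ≡ (+ 1 - B , a) ⊗ θ²ⁿ⁺¹
  θ²ⁿ⁺¹-[Mθ-p]≡[1-B+aφ]θ²ⁿ⁺¹ a B = ≡-by-coords (re u v a B) (im u v a B)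
    where
    re : ∀ u v a B →
      let F₂ₙ = u + + 2 * v
          F₂ₙ₊₁ = + 2 * u + + 3 * v
      in - F₂ₙ₊₁ + - F₂ₙ + - (- (F₂ₙ * a + F₂ₙ₊₁ * B) + - (F₂ₙ * B + F₂ₙ₊₁ * a - F₂ₙ * a)) ≡ (+ 1 - B) * (- F₂ₙ₊₁ + - F₂ₙ) + a * (F₂ₙ₊₁ + - (+ 0))
    re = solve-∀
    im : ∀ u v a B →
      let F₂ₙ = u + + 2 * v
          F₂ₙ₊₁ = + 2 * u + + 3 * v
      in F₂ₙ₊₁ + - (+ 0) + - (F₂ₙ * a + F₂ₙ₊₁ * B + - (+ 0)) ≡ (+ 1 - B) * (F₂ₙ₊₁ + - (+ 0)) + a * (- F₂ₙ₊₁ + - F₂ₙ) + a * (F₂ₙ₊₁ + - (+ 0))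
    im = solve-∀

  [θ²ⁿ⁺¹-[Mθ-p]]⊕[1-θ²ⁿ⁺¹] : ∀ M p → (θ²ⁿ⁺¹ ⊖ (θ· M ⊖ ι p)) ⊕ (1φ ⊖ θ²ⁿ⁺¹) ≡ ι (+ 1 + p) ⊖ θ· M
  [θ²ⁿ⁺¹-[Mθ-p]]⊕[1-θ²ⁿ⁺¹] M p = ≡-by-coords (re u v M p) (im u v M p)
    where
    re : ∀ u v M p →
      let F₂ₙ = u + + 2 * v
          F₂ₙ₊₁ = + 2 * u + + 3 * v
      in - F₂ₙ₊₁ + - F₂ₙ + - (- M + - p) + (+ 1 + - (- F₂ₙ₊₁ + - F₂ₙ)) ≡ + 1 + p + - (- M)
    re = solve-∀
    im : ∀ u v M p →
      let F₂ₙ₊₁ = + 2 * u + + 3 * v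
      in F₂ₙ₊₁ + - (+ 0) + - (M + - (+ 0)) + (+ 0 + - (F₂ₙ₊₁ + - (+ 0))) ≡ + 0 + - M
    im = solve-∀

module Argument (U′ V′ : ℕ) (U²+UV≡V²+1 : suc U′ ℕ.* suc U′ ℕ.+ suc U′ ℕ.* suc V′ ≡ suc V′ ℕ.* suc V′ ℕ.+ 1) where

  open import Data.Nat using (z≤n; s≤s; _∸_)
  import Data.Nat.Properties as ℕ
  open import Data.Nat.Tactic.RingSolver renaming (solve-∀ to solveℕ)
  open import Data.Integer using (_+_; _*_; -_; _-_; _≤_; _<_; +≤+; +<+)
  import Data.Integer.Properties as ℤ
  open import Data.Integer.Tactic.RingSolver using (solve-∀)
  open import Data.Product using (_×_; _,_; proj₁; proj₂)
  open import Data.Empty using (⊥-elim)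
  open import Data.Sum using (_⊎_; inj₁; inj₂)
  open import Relation.Nullary using (¬_)
  open import Relation.Binary.PropositionalEquality using (refl; sym; trans; cong; cong₂; subst; subst₂; module ≡-Reasoning)
  open GoldenIntegers
  open Floorθ

  U V : ℕ
  U = suc U′
  V = suc V′

  open Quantities (+ U) (+ V)

  cassini≡0 : cassini ≡ + 0
  cassini≡0 = begin
    u² + uv - v² - + 1        ≡⟨ regroup (+ U * + U) (+ U * + V) (+ V * + V) ⟩
    (u² + uv) - (v² + + 1)    ≡⟨ cong (λ x → x - (v² + + 1)) u²+uv≡v²+1 ⟩
    (v² + + 1) - (v² + + 1)   ≡⟨ ℤ.+-inverseʳ (v² + + 1) ⟩
    + 0                       ∎
    where
    open ≡-Reasoning
    u² uv v² : ℤ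
    u² = + U * + U
    uv = + U * + V
    v² = + V * + V
    regroup : ∀ x y z → x + y - z - + 1 ≡ (x + y) - (z + + 1)
    regroup = solve-∀
    u²+uv≡v²+1 : u² + uv ≡ v² + + 1
    u²+uv≡v²+1 = trans (cong₂ _+_ (sym (ℤ.pos-* U U)) (sym (ℤ.pos-* U V)))
      (trans (sym (ℤ.pos-+ (U ℕ.* U) (U ℕ.* V))) (trans (cong +_ U²+UV≡V²+1) (cong (λ x → x + + 1) (ℤ.pos-* V V))))

  open Identities (+ U) (+ V) cassini≡0

  -- U and V are successors, so the coordinates below evaluate to + n or
  -- +[1+ n ] and their signs are checked by computation.
  positive-φ²ⁿ⁻² : Positive φ²ⁿ⁻²
  positive-φ²ⁿ⁻² = positiveCoords⇒positive (+≤+ z≤n , +<+ (s≤s z≤n))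

  positive-φ²ⁿ⁻¹ : Positive φ²ⁿ⁻¹
  positive-φ²ⁿ⁻¹ = positiveCoords⇒positive (+≤+ z≤n , +<+ (s≤s z≤n))

  positive-φ²ⁿ⁺¹ : Positive φ²ⁿ⁺¹
  positive-φ²ⁿ⁺¹ = positiveCoords⇒positive (+≤+ z≤n , +<+ (s≤s z≤n))

  positive-θ²ⁿ⁺¹ : Positive θ²ⁿ⁺¹
  positive-θ²ⁿ⁺¹ = positive-by-product θ²ⁿ⁺¹⊗φ²ⁿ⁺¹ positive-1φ positive-φ²ⁿ⁺¹

  positive-θ²ⁿ⁻¹ : Positive θ²ⁿ⁻¹
  positive-θ²ⁿ⁻¹ = positive-by-product θ²ⁿ⁻¹⊗φ²ⁿ⁻¹ positive-1φ positive-φ²ⁿ⁻¹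

  positive-θ²ⁿ⁻³ : Positive θ²ⁿ⁻³
  positive-θ²ⁿ⁻³ = positive-by-product θ²ⁿ⁻³⊗φ²ⁿ⁻² (positiveCoords⇒positive (+≤+ z≤n , +<+ (s≤s z≤n))) positive-φ²ⁿ⁻²

  positive-1-θ²ⁿ⁺¹ : Positive (1φ ⊖ θ²ⁿ⁺¹)
  positive-1-θ²ⁿ⁺¹ = positive-by-product [1-θ²ⁿ⁺¹]⊗φ²ⁿ⁺¹ (positiveCoords⇒positive (+≤+ z≤n , +<+ (s≤s z≤n))) positive-φ²ⁿ⁺¹

  positive-θ-θ²ⁿ⁺¹ : Positive (θ ⊖ θ²ⁿ⁺¹)
  positive-θ-θ²ⁿ⁺¹ = positive-by-product [θ-θ²ⁿ⁺¹]⊗φ²ⁿ⁺¹ (positiveCoords⇒positive (+≤+ z≤n , +<+ (s≤s z≤n))) positive-φ²ⁿ⁺¹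

  positive-φ²-θ²ⁿ⁻² : Positive φ²-θ²ⁿ⁻²
  positive-φ²-θ²ⁿ⁻² = positive-by-product [φ²-θ²ⁿ⁻²]⊗φ²ⁿ⁻² (positiveCoords⇒positive (+≤+ z≤n , +<+ (s≤s z≤n))) positive-φ²ⁿ⁻²

  record LatticePoint (M : ℤ) : Set where
    field
      a B : ℤ
      0<a : + 0 < a
      B-aφ>0 : Positive (B , - a)
      1-B+aφ>0 : Positive (+ 1 - B , a)
      M≡ : M ≡ F₂ₙ * a + F₂ₙ₊₁ * B

  -- The lattice point is (a , B) = (- α M p , β M p), so that Mθ - p = (B - aφ)θ²ⁿ⁺¹.
  smallFraction⇒latticePoint : ∀ {M p} → + 0 < M → + 0 ≤ p →
    Positive (θ· M ⊖ ι p) → Positive (θ²ⁿ⁺¹ ⊖ (θ· M ⊖ ι p)) → LatticePoint M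
  smallFraction⇒latticePoint {M} {p} 0<M 0≤p frac>0 frac<θ²ⁿ⁺¹ = record
    { a = - α M p
    ; B = β M p
    ; 0<a = ℤ.neg-mono-< α<0
    ; B-aφ>0 = subst (λ y → Positive (β M p , y)) (sym (ℤ.neg-involutive (α M p))) β+αφ>0
    ; 1-B+aφ>0 = 1-β-αφ>0
    ; M≡ = M≡F₂ₙa+F₂ₙ₊₁B M p
    }
    where
    β+αφ>0 : Positive (β M p , α M p)
    β+αφ>0 = subst Positive (φ²ⁿ⁺¹⊗[Mθ-p] M p) (positive-⊗ positive-φ²ⁿ⁺¹ frac>0)
    1-β-αφ>0 : Positive (+ 1 - β M p , - α M p)
    1-β-αφ>0 = subst Positive (φ²ⁿ⁺¹⊗[θ²ⁿ⁺¹-[Mθ-p]] M p) (positive-⊗ positive-φ²ⁿ⁺¹ frac<θ²ⁿ⁺¹)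
    α<0 : α M p < + 0
    α<0 = fraction-with-positive-conj⇒a<0 β+αφ>0 1-β-αφ>0
      (subst Positive ([p+Mφ]⊗θ²ⁿ⁺¹ M p) (positive-⊗ (positiveCoords⇒positive (0≤p , 0<M)) positive-θ²ⁿ⁺¹))

  0<F₂ₙ+F₂ₙ₊₁ : + 0 < F₂ₙ + F₂ₙ₊₁
  0<F₂ₙ+F₂ₙ₊₁ = +<+ (s≤s z≤n)

  0<L₂ₙ : + 0 < L₂ₙ
  0<L₂ₙ = +<+ (s≤s z≤n)

  0<F₂ₙ₋₁ : + 0 < F₂ₙ₋₁
  0<F₂ₙ₋₁ = +<+ (s≤s z≤n)

  -- If t₀ ≤ 0 then -(B - aφ) = m θ²ⁿ⁻¹ + (- t₀)(2 + φ) > 0; otherwise 1 - B + aφ > 0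
  -- forces m > 2F₂ₙ + F₂ₙ₊₁, which makes j - J positive.
  latticePoint⇒J<j : ∀ j → LatticePoint (L₂ₙ * j) → J < j
  latticePoint⇒J<j j P = cases (≤0⊎0< t₀)
    where
    open LatticePoint P
    m t₀ : ℤ
    m = μ j a B
    t₀ = m * F₂ₙ₋₁ - a
    solution = general-solution₀ j a B M≡
    lower : Positive (L₂ₙ * m - + 2 * a , - a)
    lower = subst (λ b → Positive (b , - a)) (proj₁ solution) B-aφ>0
    upper : Positive (+ 1 - (L₂ₙ * m - + 2 * a) , a)
    upper = subst (λ b → Positive (+ 1 - b , a)) (proj₁ solution) 1-B+aφ>0
    0<m : Positive (ι m)
    0<m = positive-cancelʳ (subst Positive ([Lm-2a-aφ]⊕[2a+aφ] m a)
      (positive-⊕-nonNeg lower (0≤* {+ 2} (+≤+ z≤n) (ℤ.<⇒≤ 0<a) , ℤ.<⇒≤ 0<a))) (0<⇒positive-ι 0<L₂ₙ)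
    cases : t₀ ≤ + 0 ⊎ + 0 < t₀ → J < j
    cases (inj₁ t₀≤0) = ⊥-elim (positive-asym lower (subst Positive (sym (⊝[B-aφ]₀ m a))
      (positive-⊕-nonNeg (positive-⊗ 0<m positive-θ²ⁿ⁻¹) (nonNeg-[2+φ] (ℤ.neg-mono-≤ t₀≤0)))))
    cases (inj₂ 0<t₀) = 0<x-y⇒y<x (subst (+ 0 <_) (sym j-J≡)
      (ℤ.+-mono-<-≤ (ℤ.+-mono-<-≤ 0<F₂ₙ+F₂ₙ₊₁ (0≤* {F₂ₙ} (+≤+ z≤n) 0≤m-2F₂ₙ-F₂ₙ₊₁-1)) (0<⇒0≤pred 0<t₀)))
      where
      0≤m-2F₂ₙ-F₂ₙ₊₁-1 : + 0 ≤ m - + 2 * F₂ₙ - F₂ₙ₊₁ - + 1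
      0≤m-2F₂ₙ-F₂ₙ₊₁-1 = 0<⇒0≤pred (positive-ι⇒0< (subst Positive ([1-B+aφ]₀ m a)
        (positive-⊕ (positive-⊗ (positive-⊕-nonNeg upper (nonNeg-[2+φ] (0<⇒0≤pred 0<t₀))) positive-φ²ⁿ⁻¹) positive-θ²ⁿ⁺¹)))
      j-J≡ : j - J ≡ F₂ₙ + F₂ₙ₊₁ + F₂ₙ * (m - + 2 * F₂ₙ - F₂ₙ₊₁ - + 1) + (t₀ - + 1)
      j-J≡ = trans (cong (λ x → x - J) (proj₂ solution)) (j-J₀ m a)

  -- Three of the four sign patterns of m - 3 and t₁ contradict 0 < B - aφ < 1 or
  -- 0 < j; the fourth makes j - J nonnegative.
  latticePoint⇒J≤j : ∀ j → + 0 < j → LatticePoint (L₂ₙ * j + + 1) → J ≤ j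
  latticePoint⇒J≤j j 0<j P = cases (≤0⊎0< (m - + 3)) (≤0⊎0< t₁)
    where
    open LatticePoint P
    m t₁ : ℤ
    m = μ j a B
    t₁ = (m - + 4) * F₂ₙ₋₁ + + U - a
    solution = general-solution₁ j a B M≡
    lower : Positive (L₂ₙ * m - + 5 * F₂ₙ₊₁ - + 2 * a , - a)
    lower = subst (λ b → Positive (b , - a)) (proj₁ solution) B-aφ>0
    upper : Positive (+ 1 - (L₂ₙ * m - + 5 * F₂ₙ₊₁ - + 2 * a) , a)
    upper = subst (λ b → Positive (+ 1 - b , a)) (proj₁ solution) 1-B+aφ>0
    3-m≥0 : m - + 3 ≤ + 0 → + 0 ≤ - (m - + 4) - + 1
    3-m≥0 m≤3 = subst (+ 0 ≤_) (3-m≡ m) (ℤ.neg-mono-≤ m≤3)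
      where
      3-m≡ : ∀ m → - (m - + 3) ≡ - (m - + 4) - + 1
      3-m≡ = solve-∀
    m-4≥0 : + 0 < m - + 3 → + 0 ≤ m - + 4
    m-4≥0 m>3 = subst (+ 0 ≤_) (m-4≡ m) (0<⇒0≤pred m>3)
      where
      m-4≡ : ∀ m → m - + 3 - + 1 ≡ m - + 4
      m-4≡ = solve-∀
    cases : m - + 3 ≤ + 0 ⊎ + 0 < m - + 3 → t₁ ≤ + 0 ⊎ + 0 < t₁ → J ≤ j
    cases (inj₁ m≤3) (inj₂ 0<t₁) = ⊥-elim (positive-asym upper (subst Positive (sym (⊝[1-B+aφ]₁ m a))
      (positive-⊕-scaled (positive-⊕-nonNeg positive-φ²-θ²ⁿ⁻² (nonNeg-[2+φ] (0<⇒0≤pred 0<t₁))) (3-m≥0 m≤3) positive-θ²ⁿ⁻¹)))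
    cases (inj₁ m≤3) (inj₁ t₁≤0) = ⊥-elim (positive-asym (0<⇒positive-ι 0<j) (0<⇒positive-ι { - j} 0<-j))
      where
      0<-j : + 0 < - j
      0<-j = subst (+ 0 <_) (trans (sym (-j₁ m a)) (cong -_ (sym (proj₂ solution))))
        (ℤ.+-mono-<-≤ (ℤ.+-mono-<-≤ 0<F₂ₙ₋₁ (0≤* (3-m≥0 m≤3) (+≤+ z≤n))) (ℤ.neg-mono-≤ t₁≤0))
    cases (inj₂ m>3) (inj₁ t₁≤0) = ⊥-elim (positive-asym lower (subst Positive (sym (⊝[B-aφ]₁ m a))
      (positive-⊕-scaled (positive-⊕-nonNeg positive-θ²ⁿ⁻³ (nonNeg-[2+φ] (ℤ.neg-mono-≤ t₁≤0))) (m-4≥0 m>3) positive-θ²ⁿ⁻¹)))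
    cases (inj₂ m>3) (inj₂ 0<t₁) = ℤ.0≤i-j⇒j≤i (subst (+ 0 ≤_) (sym j-J≡)
      (ℤ.+-mono-≤ (0≤* {F₂ₙ} (+≤+ z≤n) 0≤m-2-2F₂ₙ-F₂ₙ₊₁) (0<⇒0≤pred 0<t₁)))
      where
      0≤m-2-2F₂ₙ-F₂ₙ₊₁ : + 0 ≤ m - + 2 - + 2 * F₂ₙ - F₂ₙ₊₁
      0≤m-2-2F₂ₙ-F₂ₙ₊₁ = subst (+ 0 ≤_) (shift m F₂ₙ F₂ₙ₊₁) (0<⇒0≤pred (positive-ι⇒0< (subst Positive ([1-B+aφ]₁ m a)
        (positive-⊕ (positive-⊕ (positive-⊗ (positive-⊕-nonNeg upper (nonNeg-[2+φ] (0<⇒0≤pred 0<t₁))) positive-φ²ⁿ⁻¹)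
          positive-θ²ⁿ⁺¹) positive-θ²))))
        where
        shift : ∀ m x y → m - + 1 - + 2 * x - y - + 1 ≡ m - + 2 - + 2 * x - y
        shift = solve-∀
      j-J≡ : j - J ≡ F₂ₙ * (m - + 2 - + 2 * F₂ₙ - F₂ₙ₊₁) + (t₁ - + 1)
      j-J≡ = trans (cong (λ x → x - J) (proj₂ solution)) (j-J₁ m a)

  0<L₂ₙ-1 : + 0 < L₂ₙ - + 1
  0<L₂ₙ-1 = +<+ (ℕ.≤-trans (s≤s z≤n) (ℕ.m≤n+m _ _))

  M⋆θ-p⋆>0 : Positive (θ· M⋆ ⊖ ι p⋆)
  M⋆θ-p⋆>0 = subst Positive (sym (Mθ-p≡[B-aφ]θ²ⁿ⁺¹ a⋆ B⋆)) (positive-⊗ B⋆-a⋆φ>0 positive-θ²ⁿ⁺¹)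
    where
    B⋆-a⋆φ>0 : Positive (B⋆ , - a⋆)
    B⋆-a⋆φ>0 = positive-by-product [B⋆-a⋆φ]⊗φ²ⁿ⁻¹ (positive-⊗ (0<⇒positive-ι 0<L₂ₙ-1) positive-θ) positive-φ²ⁿ⁻¹

  M⋆θ-p⋆<θ²ⁿ⁺¹ : Positive (θ²ⁿ⁺¹ ⊖ (θ· M⋆ ⊖ ι p⋆))
  M⋆θ-p⋆<θ²ⁿ⁺¹ = subst Positive (sym (θ²ⁿ⁺¹-[Mθ-p]≡[1-B+aφ]θ²ⁿ⁺¹ a⋆ B⋆)) (positive-⊗ 1-B⋆+a⋆φ>0 positive-θ²ⁿ⁺¹)
    where
    1-B⋆+a⋆φ>0 : Positive (+ 1 - B⋆ , a⋆)
    1-B⋆+a⋆φ>0 = positive-by-product [1-B⋆+a⋆φ]⊗φ²ⁿ⁻¹ positive-θ-θ²ⁿ⁺¹ positive-φ²ⁿ⁻¹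

  F₂ₙ₋₁ᴺ F₂ₙᴺ F₂ₙ₊₁ᴺ L₂ₙᴺ Jᴺ : ℕ
  F₂ₙ₋₁ᴺ = U ℕ.+ V
  F₂ₙᴺ = U ℕ.+ 2 ℕ.* V
  F₂ₙ₊₁ᴺ = 2 ℕ.* U ℕ.+ 3 ℕ.* V
  L₂ₙᴺ = 3 ℕ.* U ℕ.+ 4 ℕ.* V
  Jᴺ = F₂ₙᴺ ℕ.* F₂ₙᴺ ℕ.+ F₂ₙ₊₁ᴺ ℕ.* F₂ₙ₊₁ᴺ ∸ F₂ₙ₊₁ᴺ

  +F₂ₙᴺ : + F₂ₙᴺ ≡ F₂ₙ
  +F₂ₙᴺ = trans (ℤ.pos-+ U (2 ℕ.* V)) (cong (_+_ (+ U)) (ℤ.pos-* 2 V))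

  +F₂ₙ₊₁ᴺ : + F₂ₙ₊₁ᴺ ≡ F₂ₙ₊₁
  +F₂ₙ₊₁ᴺ = trans (ℤ.pos-+ (2 ℕ.* U) (3 ℕ.* V)) (cong₂ _+_ (ℤ.pos-* 2 U) (ℤ.pos-* 3 V))

  +L₂ₙᴺ : + L₂ₙᴺ ≡ L₂ₙ
  +L₂ₙᴺ = trans (ℤ.pos-+ (3 ℕ.* U) (4 ℕ.* V)) (cong₂ _+_ (ℤ.pos-* 3 U) (ℤ.pos-* 4 V))

  Jᴺ+F₂ₙ₊₁ᴺ≡ : Jᴺ ℕ.+ F₂ₙ₊₁ᴺ ≡ F₂ₙᴺ ℕ.* F₂ₙᴺ ℕ.+ F₂ₙ₊₁ᴺ ℕ.* F₂ₙ₊₁ᴺ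
  Jᴺ+F₂ₙ₊₁ᴺ≡ = ℕ.m∸n+n≡m (ℕ.≤-trans (ℕ.m≤m*n F₂ₙ₊₁ᴺ F₂ₙ₊₁ᴺ) (ℕ.m≤n+m (F₂ₙ₊₁ᴺ ℕ.* F₂ₙ₊₁ᴺ) (F₂ₙᴺ ℕ.* F₂ₙᴺ)))

  +Jᴺ : + Jᴺ ≡ J
  +Jᴺ = x+y≡z⇒x≡z-y {+ Jᴺ} {F₂ₙ₊₁} (begin
    + Jᴺ + F₂ₙ₊₁                        ≡⟨ cong (_+_ (+ Jᴺ)) (sym +F₂ₙ₊₁ᴺ) ⟩
    + (Jᴺ ℕ.+ F₂ₙ₊₁ᴺ)                   ≡⟨ cong +_ Jᴺ+F₂ₙ₊₁ᴺ≡ ⟩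
    + (F₂ₙᴺ ℕ.* F₂ₙᴺ ℕ.+ F₂ₙ₊₁ᴺ ℕ.* F₂ₙ₊₁ᴺ) ≡⟨ ℤ.pos-+ (F₂ₙᴺ ℕ.* F₂ₙᴺ) (F₂ₙ₊₁ᴺ ℕ.* F₂ₙ₊₁ᴺ) ⟩
    + (F₂ₙᴺ ℕ.* F₂ₙᴺ) + + (F₂ₙ₊₁ᴺ ℕ.* F₂ₙ₊₁ᴺ) ≡⟨ cong₂ _+_ (ℤ.pos-* F₂ₙᴺ F₂ₙᴺ) (ℤ.pos-* F₂ₙ₊₁ᴺ F₂ₙ₊₁ᴺ) ⟩
    + F₂ₙᴺ * + F₂ₙᴺ + + F₂ₙ₊₁ᴺ * + F₂ₙ₊₁ᴺ ≡⟨ cong₂ (λ x y → x * x + y * y) +F₂ₙᴺ +F₂ₙ₊₁ᴺ ⟩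
    F₂ₙ * F₂ₙ + F₂ₙ₊₁ * F₂ₙ₊₁ ∎)
    where
    open ≡-Reasoning
    x+y≡z⇒x≡z-y : ∀ {x y z} → x + y ≡ z → x ≡ z - y
    x+y≡z⇒x≡z-y {x} {y} refl = lemma x y
      where
      lemma : ∀ x y → x ≡ x + y - y
      lemma = solve-∀

  2≤Jᴺ : 2 ℕ.≤ Jᴺ
  2≤Jᴺ = ℕ.≤-trans 2≤F₂ₙᴺ (ℕ.≤-trans (ℕ.m≤m*n F₂ₙᴺ F₂ₙᴺ) (ℕ.+-cancelʳ-≤ F₂ₙ₊₁ᴺ _ _
    (subst (F₂ₙᴺ ℕ.* F₂ₙᴺ ℕ.+ F₂ₙ₊₁ᴺ ℕ.≤_) (sym Jᴺ+F₂ₙ₊₁ᴺ≡) (ℕ.+-monoʳ-≤ (F₂ₙᴺ ℕ.* F₂ₙᴺ) (ℕ.m≤m*n F₂ₙ₊₁ᴺ F₂ₙ₊₁ᴺ)))))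
    where
    2≤F₂ₙᴺ : 2 ℕ.≤ F₂ₙᴺ
    2≤F₂ₙᴺ = ℕ.≤-trans (ℕ.*-monoʳ-≤ 2 (s≤s z≤n)) (ℕ.m≤n+m (2 ℕ.* V) U)

  δ≡θ²ⁿ⁺¹ : θ· + F₂ₙ₊₁ᴺ ⊖ ι (+ F₂ₙᴺ) ≡ θ²ⁿ⁺¹
  δ≡θ²ⁿ⁺¹ = cong₂ (λ y x → θ· y ⊖ ι x) +F₂ₙ₊₁ᴺ +F₂ₙᴺ

  positive-δ : Positive (θ· + F₂ₙ₊₁ᴺ ⊖ ι (+ F₂ₙᴺ))
  positive-δ = subst Positive (sym δ≡θ²ⁿ⁺¹) positive-θ²ⁿ⁺¹

  positive-1-δ : Positive (1φ ⊖ (θ· + F₂ₙ₊₁ᴺ ⊖ ι (+ F₂ₙᴺ)))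
  positive-1-δ = subst (λ δ → Positive (1φ ⊖ δ)) (sym δ≡θ²ⁿ⁺¹) positive-1-θ²ⁿ⁺¹

  N : ℕ → ℕ
  N k = L₂ₙᴺ ℕ.* k ℕ.+ F₂ₙ₋₁ᴺ

  0<N : ∀ k → 0 ℕ.< N k
  0<N k = ℕ.≤-trans (s≤s z≤n) (ℕ.m≤n+m F₂ₙ₋₁ᴺ (L₂ₙᴺ ℕ.* k))

  N+F₂ₙ₊₁ᴺ≡ : ∀ k → N k ℕ.+ F₂ₙ₊₁ᴺ ≡ L₂ₙᴺ ℕ.* suc k
  N+F₂ₙ₊₁ᴺ≡ k = lemma U V k
    where
    lemma : ∀ U V k → (3 ℕ.* U ℕ.+ 4 ℕ.* V) ℕ.* k ℕ.+ (U ℕ.+ V) ℕ.+ (2 ℕ.* U ℕ.+ 3 ℕ.* V) ≡ (3 ℕ.* U ℕ.+ 4 ℕ.* V) ℕ.* suc k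
    lemma = solveℕ

  +[N+F₂ₙ₊₁ᴺ] : ∀ k → + (N k ℕ.+ F₂ₙ₊₁ᴺ) ≡ L₂ₙ * + suc k
  +[N+F₂ₙ₊₁ᴺ] k = trans (cong +_ (N+F₂ₙ₊₁ᴺ≡ k)) (trans (ℤ.pos-* L₂ₙᴺ (suc k)) (cong (λ x → x * + suc k) +L₂ₙᴺ))

  +[1+N+F₂ₙ₊₁ᴺ] : ∀ k → + (suc (N k) ℕ.+ F₂ₙ₊₁ᴺ) ≡ L₂ₙ * + suc k + + 1
  +[1+N+F₂ₙ₊₁ᴺ] k = trans (cong +_ (ℕ.+-comm 1 (N k ℕ.+ F₂ₙ₊₁ᴺ)))
    (trans (ℤ.pos-+ (N k ℕ.+ F₂ₙ₊₁ᴺ) 1) (cong (λ x → x + + 1) (+[N+F₂ₙ₊₁ᴺ] k)))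

  -- {Mθ} < F₂ₙ₊₁θ - F₂ₙ, so that ⌊Mθ⌋ = ⌊(M - F₂ₙ₊₁)θ⌋ + F₂ₙ + 1.
  Carries : ℕ → Set
  Carries M = Positive ((θ· + F₂ₙ₊₁ᴺ ⊖ ι (+ F₂ₙᴺ)) ⊖ (θ· + M ⊖ ι (+ floorθ M)))

  carries⇒latticePoint : ∀ {M} → 0 ℕ.< M → Carries M → LatticePoint (+ M)
  carries⇒latticePoint {M} 0<M carries = smallFraction⇒latticePoint (+<+ 0<M) (+≤+ z≤n) (floorθ-lower M 0<M)
    (subst (λ δ → Positive (δ ⊖ (θ· + M ⊖ ι (+ floorθ M)))) δ≡θ²ⁿ⁺¹ carries)

  ¬carries₀ : ∀ k → suc k ℕ.≤ Jᴺ → ¬ Carries (N k ℕ.+ F₂ₙ₊₁ᴺ)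
  ¬carries₀ k k<Jᴺ carries = ℕ.<⇒≱ (ℤ.drop‿+<+ (subst (_< + suc k) (sym +Jᴺ) J<k+1)) k<Jᴺ
    where
    J<k+1 : J < + suc k
    J<k+1 = latticePoint⇒J<j (+ suc k)
      (subst LatticePoint (+[N+F₂ₙ₊₁ᴺ] k) (carries⇒latticePoint (ℕ.≤-trans (0<N k) (ℕ.m≤m+n (N k) F₂ₙ₊₁ᴺ)) carries))

  ¬carries₁ : ∀ k → suc (suc k) ℕ.≤ Jᴺ → ¬ Carries (suc (N k) ℕ.+ F₂ₙ₊₁ᴺ)
  ¬carries₁ k k+1<Jᴺ carries = ℕ.<⇒≱ k+1<Jᴺ (ℤ.drop‿+≤+ (subst (_≤ + suc k) (sym +Jᴺ) J≤k+1))
    where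
    J≤k+1 : J ≤ + suc k
    J≤k+1 = latticePoint⇒J≤j (+ suc k) (+<+ (s≤s z≤n))
      (subst LatticePoint (+[1+N+F₂ₙ₊₁ᴺ] k) (carries⇒latticePoint {suc (N k) ℕ.+ F₂ₙ₊₁ᴺ} (s≤s z≤n) carries))

  carries⋆ : ∀ k → suc k ≡ Jᴺ → Carries (suc (N k) ℕ.+ F₂ₙ₊₁ᴺ)
  carries⋆ k 1+k≡Jᴺ = subst (λ p → Positive (δ ⊖ (θ· + M ⊖ ι p))) p⋆≡floor
    (subst₂ (λ δ x → Positive (δ ⊖ (θ· x ⊖ ι p⋆))) (sym δ≡θ²ⁿ⁺¹) (sym +M≡M⋆) M⋆θ-p⋆<θ²ⁿ⁺¹)
    where
    δ : ℤφ
    δ = θ· + F₂ₙ₊₁ᴺ ⊖ ι (+ F₂ₙᴺ)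
    M : ℕ
    M = suc (N k) ℕ.+ F₂ₙ₊₁ᴺ
    +M≡M⋆ : + M ≡ M⋆
    +M≡M⋆ = trans (+[1+N+F₂ₙ₊₁ᴺ] k) (trans (cong (λ j → L₂ₙ * j + + 1) (trans (cong +_ 1+k≡Jᴺ) +Jᴺ)) (sym M⋆≡))
    p⋆≡floor : p⋆ ≡ + floorθ M
    p⋆≡floor = floorθ-unique M (s≤s z≤n) p⋆
      (subst (λ x → Positive (θ· x ⊖ ι p⋆)) (sym +M≡M⋆) M⋆θ-p⋆>0)
      (subst (λ x → Positive (ι (+ 1 + p⋆) ⊖ θ· x)) (sym +M≡M⋆)
        (subst Positive ([θ²ⁿ⁺¹-[Mθ-p]]⊕[1-θ²ⁿ⁺¹] M⋆ p⋆) (positive-⊕ M⋆θ-p⋆<θ²ⁿ⁺¹ positive-1-θ²ⁿ⁺¹)))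

  s≡ : ∀ i M → i ℕ.+ 1 ≡ M → s i ≡ floorθ (suc M) ∸ floorθ M
  s≡ i M refl = cong (λ x → floorθ x ∸ floorθ (i ℕ.+ 1)) (ℕ.+-suc i 1)

  left-index : ∀ k → L₂ₙᴺ ℕ.* k ℕ.+ (F₂ₙ₋₁ᴺ ∸ 1) ℕ.+ 1 ≡ N k
  left-index k = trans (ℕ.+-assoc (L₂ₙᴺ ℕ.* k) (F₂ₙ₋₁ᴺ ∸ 1) 1) (cong (ℕ._+_ (L₂ₙᴺ ℕ.* k)) (ℕ.m∸n+n≡m (s≤s z≤n)))

  right-index : ∀ k → L₂ₙᴺ ℕ.* k ℕ.+ (L₂ₙᴺ ∸ 1) ℕ.+ 1 ≡ N k ℕ.+ F₂ₙ₊₁ᴺ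
  right-index k = trans (ℕ.+-assoc (L₂ₙᴺ ℕ.* k) (L₂ₙᴺ ∸ 1) 1)
    (trans (cong (ℕ._+_ (L₂ₙᴺ ℕ.* k)) (ℕ.m∸n+n≡m (s≤s z≤n))) (lemma U V k))
    where
    lemma : ∀ U V k → (3 ℕ.* U ℕ.+ 4 ℕ.* V) ℕ.* k ℕ.+ (3 ℕ.* U ℕ.+ 4 ℕ.* V) ≡ (3 ℕ.* U ℕ.+ 4 ℕ.* V) ℕ.* k ℕ.+ (U ℕ.+ V) ℕ.+ (2 ℕ.* U ℕ.+ 3 ℕ.* V)
    lemma = solveℕ

  shift₀ : ∀ k → suc k ℕ.≤ Jᴺ → F₂ₙᴺ ℕ.+ floorθ (N k) ≡ floorθ (N k ℕ.+ F₂ₙ₊₁ᴺ)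
  shift₀ k k<Jᴺ = floorθ-shift F₂ₙ₊₁ᴺ F₂ₙᴺ positive-δ positive-1-δ (N k) (0<N k) (¬carries₀ k k<Jᴺ)

  shift₁ : ∀ k → suc (suc k) ℕ.≤ Jᴺ → F₂ₙᴺ ℕ.+ floorθ (suc (N k)) ≡ floorθ (suc (N k) ℕ.+ F₂ₙ₊₁ᴺ)
  shift₁ k k+1<Jᴺ = floorθ-shift F₂ₙ₊₁ᴺ F₂ₙᴺ positive-δ positive-1-δ (suc (N k)) (s≤s z≤n) (¬carries₁ k k+1<Jᴺ)

  shift⋆ : ∀ k → suc k ≡ Jᴺ → suc (F₂ₙᴺ ℕ.+ floorθ (suc (N k))) ≡ floorθ (suc (N k) ℕ.+ F₂ₙ₊₁ᴺ)
  shift⋆ k 1+k≡Jᴺ = floorθ-shift-carry F₂ₙ₊₁ᴺ F₂ₙᴺ positive-δ positive-1-δ (suc (N k)) (s≤s z≤n) (carries⋆ k 1+k≡Jᴺ)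

  s-agree : ∀ k → k ℕ.≤ Jᴺ ∸ 2 → s (L₂ₙᴺ ℕ.* k ℕ.+ (F₂ₙ₋₁ᴺ ∸ 1)) ≡ s (L₂ₙᴺ ℕ.* k ℕ.+ (L₂ₙᴺ ∸ 1))
  s-agree k k≤Jᴺ-2 = begin
    s (L₂ₙᴺ ℕ.* k ℕ.+ (F₂ₙ₋₁ᴺ ∸ 1))                                 ≡⟨ s≡ _ _ (left-index k) ⟩
    floorθ (suc (N k)) ∸ floorθ (N k)                               ≡⟨ sym (ℕ.[m+n]∸[m+o]≡n∸o F₂ₙᴺ _ _) ⟩
    (F₂ₙᴺ ℕ.+ floorθ (suc (N k))) ∸ (F₂ₙᴺ ℕ.+ floorθ (N k))         ≡⟨ cong₂ _∸_ (shift₁ k k+1<Jᴺ) (shift₀ k (ℕ.<⇒≤ k+1<Jᴺ)) ⟩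
    floorθ (suc (N k) ℕ.+ F₂ₙ₊₁ᴺ) ∸ floorθ (N k ℕ.+ F₂ₙ₊₁ᴺ)         ≡⟨ sym (s≡ _ _ (right-index k)) ⟩
    s (L₂ₙᴺ ℕ.* k ℕ.+ (L₂ₙᴺ ∸ 1))                                   ∎
    where
    open ≡-Reasoning
    k+1<Jᴺ : suc (suc k) ℕ.≤ Jᴺ
    k+1<Jᴺ = subst (ℕ._≤ Jᴺ) (ℕ.+-comm k 2) (subst (k ℕ.+ 2 ℕ.≤_) (ℕ.m∸n+n≡m 2≤Jᴺ) (ℕ.+-monoˡ-≤ 2 k≤Jᴺ-2))

  s-differ : s (L₂ₙᴺ ℕ.* (Jᴺ ∸ 1) ℕ.+ (F₂ₙ₋₁ᴺ ∸ 1)) ≡ 0 × s (L₂ₙᴺ ℕ.* (Jᴺ ∸ 1) ℕ.+ (L₂ₙᴺ ∸ 1)) ≡ 1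
  s-differ = left , right
    where
    open ≡-Reasoning
    k = Jᴺ ∸ 1
    1+k≡Jᴺ : suc k ≡ Jᴺ
    1+k≡Jᴺ = trans (ℕ.+-comm 1 k) (ℕ.m∸n+n≡m (ℕ.≤-trans (s≤s z≤n) 2≤Jᴺ))
    f₀ f₁ : ℕ
    f₀ = floorθ (N k)
    f₁ = floorθ (suc (N k))
    f₁≡f₀ : f₁ ≡ f₀
    f₁≡f₀ = ℕ.≤-antisym
      (ℕ.+-cancelˡ-≤ F₂ₙᴺ _ _ (ℕ.≤-pred (subst₂ ℕ._≤_ (sym (shift⋆ k 1+k≡Jᴺ)) (cong suc (sym (shift₀ k (ℕ.≤-reflexive 1+k≡Jᴺ))))
        (proj₂ (floorθ-suc (N k ℕ.+ F₂ₙ₊₁ᴺ) (ℕ.≤-trans (0<N k) (ℕ.m≤m+n (N k) F₂ₙ₊₁ᴺ)))))))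
      (proj₁ (floorθ-suc (N k) (0<N k)))
    left : s (L₂ₙᴺ ℕ.* k ℕ.+ (F₂ₙ₋₁ᴺ ∸ 1)) ≡ 0
    left = begin
      s (L₂ₙᴺ ℕ.* k ℕ.+ (F₂ₙ₋₁ᴺ ∸ 1)) ≡⟨ s≡ _ _ (left-index k) ⟩
      f₁ ∸ f₀                         ≡⟨ cong (_∸ f₀) f₁≡f₀ ⟩
      f₀ ∸ f₀                         ≡⟨ ℕ.n∸n≡0 f₀ ⟩
      0                               ∎
    right : s (L₂ₙᴺ ℕ.* k ℕ.+ (L₂ₙᴺ ∸ 1)) ≡ 1
    right = begin
      s (L₂ₙᴺ ℕ.* k ℕ.+ (L₂ₙᴺ ∸ 1))                              ≡⟨ s≡ _ _ (right-index k) ⟩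
      floorθ (suc (N k) ℕ.+ F₂ₙ₊₁ᴺ) ∸ floorθ (N k ℕ.+ F₂ₙ₊₁ᴺ)    ≡⟨ cong₂ _∸_ (sym (shift⋆ k 1+k≡Jᴺ)) (sym (shift₀ k (ℕ.≤-reflexive 1+k≡Jᴺ))) ⟩
      suc (F₂ₙᴺ ℕ.+ f₁) ∸ (F₂ₙᴺ ℕ.+ f₀)                          ≡⟨ cong (λ f → suc (F₂ₙᴺ ℕ.+ f) ∸ (F₂ₙᴺ ℕ.+ f₀)) f₁≡f₀ ⟩
      suc (F₂ₙᴺ ℕ.+ f₀) ∸ (F₂ₙᴺ ℕ.+ f₀)                          ≡⟨ ℕ.+-∸-assoc 1 (ℕ.≤-refl {F₂ₙᴺ ℕ.+ f₀}) ⟩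
      suc ((F₂ₙᴺ ℕ.+ f₀) ∸ (F₂ₙᴺ ℕ.+ f₀))                        ≡⟨ cong suc (ℕ.n∸n≡0 (F₂ₙᴺ ℕ.+ f₀)) ⟩
      1                                                          ∎

open import Data.Nat using (zero; _+_; _*_; _∸_; _≤_; s≤s; z≤n)
import Data.Nat.Properties as ℕ
open import Data.Nat.Tactic.RingSolver renaming (solve-∀ to solveℕ)
open import Data.Product using (_×_; _,_; ∃-syntax)
open import Relation.Binary.PropositionalEquality using (refl; sym; trans; cong; cong₂; subst; subst₂)

FirstDisagreementAt : ℕ → ℕ → ℕ → Set
FirstDisagreementAt r e J =
  ((k : ℕ) → k ≤ J ∸ 2 → s (r * k + (e ∸ 1)) ≡ s (r * k + (r ∸ 1)))
  × (s (r * (J ∸ 1) + (e ∸ 1)) ≡ 0 × s (r * (J ∸ 1) + (r ∸ 1)) ≡ 1)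

F-suc : ∀ k → ∃[ w ] F (suc k) ≡ suc w
F-suc zero = 0 , refl
F-suc (suc k) with F-suc k
... | w , F[k+1]≡1+w = w + F k , cong (_+ F k) F[k+1]≡1+w

F-+ : ∀ m k → F (suc (m + k)) ≡ F (suc m) * F (suc k) + F m * F k
F-+ zero k = x≡1x+0y (F (suc k)) (F k)
  where
  x≡1x+0y : ∀ x y → x ≡ 1 * x + 0 * y
  x≡1x+0y = solveℕ
F-+ (suc m) k = trans (cong (λ i → F (suc i)) (sym (ℕ.+-suc m k))) (trans (F-+ m (suc k)) (regroup (F (suc m)) (F m) (F (suc k)) (F k)))
  where
  regroup : ∀ p q r t → p * (r + t) + q * r ≡ (p + q) * r + p * t
  regroup = solveℕ

L-suc : ∀ k → L (suc k) ≡ F k + F (suc (suc k))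
L-suc zero = refl
L-suc (suc zero) = refl
L-suc (suc (suc k)) = trans (cong₂ _+_ (L-suc (suc k)) (L-suc k)) (regroup (F (suc k)) (F k))
  where
  regroup : ∀ p q → (p + ((p + q) + p)) + (q + (p + q)) ≡ (p + q) + (((p + q) + p) + (p + q))
  regroup = solveℕ

cassini-odd : ∀ j → F (suc (j + j)) * F (suc (j + j)) + F (suc (j + j)) * F (suc (suc (j + j)))
                    ≡ F (suc (suc (j + j))) * F (suc (suc (j + j))) + 1
cassini-odd zero = refl
cassini-odd (suc j) rewrite ℕ.+-suc j j =
  trans (step₁ (F (suc (j + j))) (F (suc (suc (j + j)))))
    (trans (cong (_+ Q (F (suc (j + j))) (F (suc (suc (j + j))))) (cassini-odd j))
      (sym (step₂ (F (suc (j + j))) (F (suc (suc (j + j)))))))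
  where
  Q : ℕ → ℕ → ℕ
  Q a b = a * a + 4 * (a * b) + 3 * (b * b)
  step₁ : ∀ a b → (b + a) * (b + a) + (b + a) * ((b + a) + b) ≡ (a * a + a * b) + (a * a + 4 * (a * b) + 3 * (b * b))
  step₁ = solveℕ
  step₂ : ∀ a b → ((b + a) + b) * ((b + a) + b) + 1 ≡ (b * b + 1) + (a * a + 4 * (a * b) + 3 * (b * b))
  step₂ = solveℕ

module _ (j U′ V′ : ℕ) (F[2n-3]≡ : F (suc (j + j)) ≡ suc U′) (F[2n-2]≡ : F (suc (suc (j + j))) ≡ suc V′) where

  private
    cassini-UV : suc U′ * suc U′ + suc U′ * suc V′ ≡ suc V′ * suc V′ + 1
    cassini-UV = subst₂ (λ a b → a * a + a * b ≡ b * b + 1) F[2n-3]≡ F[2n-2]≡ (cassini-odd j)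

  open Argument U′ V′ cassini-UV

  private
    m : ℕ
    m = j + j

    F[3+m]≡ : F (3 + m) ≡ F₂ₙ₋₁ᴺ
    F[3+m]≡ = trans (cong₂ (λ a b → b + a) F[2n-3]≡ F[2n-2]≡) (ℕ.+-comm (suc V′) (suc U′))

    F[4+m]≡ : F (4 + m) ≡ F₂ₙᴺ
    F[4+m]≡ = trans (cong₂ (λ a b → (b + a) + b) F[2n-3]≡ F[2n-2]≡) (lemma (suc U′) (suc V′))
      where
      lemma : ∀ a b → (b + a) + b ≡ a + 2 * b
      lemma = solveℕ

    F[5+m]≡ : F (5 + m) ≡ F₂ₙ₊₁ᴺ
    F[5+m]≡ = trans (cong₂ (λ a b → ((b + a) + b) + (b + a)) F[2n-3]≡ F[2n-2]≡) (lemma (suc U′) (suc V′))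
      where
      lemma : ∀ a b → ((b + a) + b) + (b + a) ≡ 2 * a + 3 * b
      lemma = solveℕ

    L[4+m]≡ : L (4 + m) ≡ L₂ₙᴺ
    L[4+m]≡ = trans (L-suc (3 + m)) (trans (cong₂ _+_ F[3+m]≡ F[5+m]≡) (lemma (suc U′) (suc V′)))
      where
      lemma : ∀ a b → (a + b) + (2 * a + 3 * b) ≡ 3 * a + 4 * b
      lemma = solveℕ

    2n≡ : 2 * suc (suc j) ≡ 4 + m
    2n≡ = lemma j
      where
      lemma : ∀ j → 2 * suc (suc j) ≡ 4 + (j + j)
      lemma = solveℕ

    J≡ : F (4 * suc (suc j) + 1) ∸ F (2 * suc (suc j) + 1) ≡ Jᴺ
    J≡ = cong₂ _∸_ (trans (cong F (lemma₁ j)) (trans (F-+ (4 + m) (4 + m))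
                      (trans (cong₂ (λ x y → y * y + x * x) F[4+m]≡ F[5+m]≡) (ℕ.+-comm (F₂ₙ₊₁ᴺ * F₂ₙ₊₁ᴺ) (F₂ₙᴺ * F₂ₙᴺ)))))
                   (trans (cong F (lemma₂ j)) F[5+m]≡)
      where
      lemma₁ : ∀ j → 4 * suc (suc j) + 1 ≡ suc ((4 + (j + j)) + (4 + (j + j)))
      lemma₁ = solveℕ
      lemma₂ : ∀ j → 2 * suc (suc j) + 1 ≡ 5 + (j + j)
      lemma₂ = solveℕ

  firstDisagreement : FirstDisagreementAt (L (2 * suc (suc j))) (F (2 * suc (suc j) ∸ 1)) (F (4 * suc (suc j) + 1) ∸ F (2 * suc (suc j) + 1))
  firstDisagreement =
    subst₂ (λ r e → FirstDisagreementAt r e (F (4 * suc (suc j) + 1) ∸ F (2 * suc (suc j) + 1)))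
      (sym (trans (cong L 2n≡) L[4+m]≡)) (sym (trans (cong (λ i → F (i ∸ 1)) 2n≡) F[3+m]≡))
      (subst (FirstDisagreementAt L₂ₙᴺ F₂ₙ₋₁ᴺ) (sym J≡) (s-agree , s-differ))

theorem12 : (n : ℕ) → 2 ≤ n →
    ((k : ℕ) → k ≤ F (4 * n + 1) ∸ F (2 * n + 1) ∸ 2 →
      s (L (2 * n) * k + (F (2 * n ∸ 1) ∸ 1)) ≡ s (L (2 * n) * k + (L (2 * n) ∸ 1)))
    × (s (L (2 * n) * (F (4 * n + 1) ∸ F (2 * n + 1) ∸ 1) + (F (2 * n ∸ 1) ∸ 1)) ≡ 0
       × s (L (2 * n) * (F (4 * n + 1) ∸ F (2 * n + 1) ∸ 1) + (L (2 * n) ∸ 1)) ≡ 1)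
theorem12 (suc (suc j)) (s≤s (s≤s z≤n)) with F-suc (j + j) | F-suc (suc (j + j))
... | U′ , F[2n-3]≡ | V′ , F[2n-2]≡ = firstDisagreement j U′ V′ F[2n-3]≡ F[2n-2]≡
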